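{- For every integer $n\ge 3$, \[p_b(C_n)=\begin{cases} \frac{n}{4} & \text{if } n\equiv 0\pmod 8,\\ 2\left\lfloor\frac{n}{8}\right\rfloor+1 & \text{if } n\equiv 1,2,3\pmod 8,\\ 2\left\lfloor\frac{n}{8}\right\rfloor+2 & \text{if } n\equiv 4,5,6,7\pmod 8,\end{cases}\] where $C_n$ is the cycle of order $n$.
   Context: For a graph $G=(V,E)$, a broadcast is a function $f:V\to\{0,\dots,\operatorname{diam}(G)\}$ with $f(v)\le e_G(v)$ (eccentricity) for all $v$. Let $V^+_f=\{v: f(v)>0\}$ and $H_f(u)=\{v\in V^+_f: d_G(u,v)\le f(v)\}$. The cost is $\sigma(f)=\sum_v f(v)$. $f$ is a packing broadcast if $|H_f(u)|\le1$ for every $u\in V$; it is maximal if no packing broadcast $g\ne f$ satisfies $g\ge f$ pointwise. $p_b(G)$ is the minimum cost of a maximal packing broadcast on $G$. -}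

module Defs where

open import Data.Nat using (ℕ; zero; suc; _+_; _∸_; _≤_; _<_; _⊔_; _⊓_; ∣_-_∣; _/_; _%_; _*_)
open import Data.Fin using (Fin; toℕ)
open import Data.List using (List; map; foldr; allFin)
open import Data.Nat.ListAction using (sum)
open import Data.Product using (Σ; _×_; _,_; ∃)
open import Relation.Binary.PropositionalEquality using (_≡_)

-- Broadcasts on a finite (connected) graph with vertex set Fin n,
-- described through its shortest-path distance function d.

module Broadcasts (n : ℕ) (d : Fin n → Fin n → ℕ) where

  maxL : List ℕ → ℕ
  maxL = foldr _⊔_ 0

  ecc : Fin n → ℕ
  ecc v = maxL (map (d v) (allFin n))

  diam : ℕ
  diam = maxL (map ecc (allFin n))

  cost : (Fin n → ℕ) → ℕ
  cost f = sum (map f (allFin n))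

  IsBroadcast : (Fin n → ℕ) → Set
  IsBroadcast f = ∀ v → (f v ≤ diam) × (f v ≤ ecc v)

  InH : (Fin n → ℕ) → Fin n → Fin n → Set
  InH f u v = (0 < f v) × (d u v ≤ f v)

  IsPacking : (Fin n → ℕ) → Set
  IsPacking f = ∀ u v w → InH f u v → InH f u w → v ≡ w

  IsPackingBroadcast : (Fin n → ℕ) → Set
  IsPackingBroadcast f = IsBroadcast f × IsPacking f

  IsMaximalPackingBroadcast : (Fin n → ℕ) → Set
  IsMaximalPackingBroadcast f =
    IsPackingBroadcast f ×
    (∀ g → IsPackingBroadcast g → (∀ v → f v ≤ g v) → ∀ v → g v ≡ f v)

  IsPb : ℕ → Set
  IsPb m =
    (Σ (Fin n → ℕ) λ f → IsMaximalPackingBroadcast f × cost f ≡ m) ×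
    (∀ g → IsMaximalPackingBroadcast g → m ≤ cost g)

-- The cycle C_n on vertices 0,…,n-1 (i adjacent to i±1 mod n);
-- its distance is d(i,j) = min(|i-j|, n-|i-j|).

cycleDist : (n : ℕ) → Fin n → Fin n → ℕ
cycleDist n i j = ∣ toℕ i - toℕ j ∣ ⊓ (n ∸ ∣ toℕ i - toℕ j ∣)

pbCycle : ℕ → ℕ → Set
pbCycle n m = Broadcasts.IsPb n (cycleDist n) m

pbFormulaAux : (n r : ℕ) → ℕ
pbFormulaAux n 0 = n / 4
pbFormulaAux n 1 = 2 * (n / 8) + 1
pbFormulaAux n 2 = 2 * (n / 8) + 1
pbFormulaAux n 3 = 2 * (n / 8) + 1
pbFormulaAux n _ = 2 * (n / 8) + 2

pbFormula : ℕ → ℕ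
pbFormula n = pbFormulaAux n (n % 8)

module Submission where

-- Lower bound: lift a maximal packing broadcast f of cost K to the cover ℕ of Cₙ and walk once
-- around through consecutive broadcasting vertices. Their balls are disjoint, and maximality
-- leaves a gap of at most 2 vertices between two consecutive balls (otherwise a vertex in the gap
-- could start broadcasting) and forbids two positive gaps in a row (otherwise the vertex between
-- them could broadcast farther). So n = 2K + m + P with m ≤ K broadcasting vertices and gap sum P,
-- and weighting the gaps shows P < m, or P ≤ m with P even; that is, n < 4K or (n ≤ 4K with K
-- even), which means exactly K ≥ pbFormula n. A vertex with 2 f(v) + 2 > n alone already costs
-- enough, and f = 0 is not maximal.
-- Upper bound: for n ≥ 6 the 1s of the cyclic word (01001000)^q 010010 (ending r) broadcast with
-- strength 1; windows of length 7 show that this is a packing in which every vertex is blocked.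
-- For n ≤ 5 a single vertex broadcasting with strength ⌊n/2⌋ suffices.

open import Defs
open import Data.Bool.Base using (Bool; true; false; _∧_; _∨_; not; T)
open import Data.Bool.Properties using (T-∧)
open import Data.Empty using (⊥; ⊥-elim)
open import Data.Fin.Base using (Fin; toℕ; fromℕ<) renaming (zero to fzero; suc to fsuc)
open import Data.Fin.Properties using (toℕ-fromℕ<; toℕ-injective; toℕ<n; any?) renaming (_≟_ to _≟ᶠ_)
open import Data.List.Base using (List; []; _∷_; _++_; length; map; foldr; take; tabulate; allFin)
open import Data.List.Properties using (length-++; ++-assoc; map-++; length-take; map-tabulate)
open import Data.List.Membership.Propositional using (_∈_)
open import Data.List.Membership.Propositional.Properties using (∈-allFin)
open import Data.List.Relation.Unary.All using (All; []; _∷_)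
open import Data.List.Relation.Unary.Any using (here; there)
open import Data.List.Relation.Unary.Linked using (Linked; []; [-]; _∷_)
open import Data.Nat.Base
open import Data.Nat.Properties
open import Data.Nat.DivMod
open import Data.Nat.Divisibility using (_∣_; divides; n∣m⇒m%n≡0; n∣n; ∣m∣n⇒∣m+n)
open import Data.Nat.ListAction using (sum)
open import Data.Nat.ListAction.Properties using (sum-++)
open import Data.Nat.Tactic.RingSolver using (solve-∀)
open import Data.Product using (Σ; _×_; _,_; proj₁; proj₂)
open import Data.Sum using (_⊎_; inj₁; inj₂)
open import Data.Unit using (tt)
open import Function.Bundles using (Equivalence)
open import Relation.Nullary using (¬_; Dec; yes; no)
open import Relation.Binary.PropositionalEquality

≤-offset : ∀ {m n} k → m + k ≡ n → m ≤ n
≤-offset {m} k refl = m≤m+n m k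

[m+kn]/n≡k : ∀ {m} k n .{{_ : NonZero n}} → m < n → (m + k * n) / n ≡ k
[m+kn]/n≡k {m} k n m<n = begin
  (m + k * n) / n       ≡⟨ +-distrib-/ m (k * n) (subst (_< n) (sym %-sum) m<n) ⟩
  m / n + k * n / n     ≡⟨ cong₂ _+_ (m<n⇒m/n≡0 m<n) (m*n/n≡m k n) ⟩
  k                     ∎
  where
  open ≡-Reasoning
  %-sum : m % n + k * n % n ≡ m
  %-sum = trans (cong₂ _+_ (m<n⇒m%n≡m m<n) (m*n%n≡0 k n)) (+-identityʳ m)

≤-half : ∀ x m → x + x ≤ m → x ≤ m / 2
≤-half x m x+x≤m = subst (_≤ m / 2) (m*n/n≡m x 2) (/-monoˡ-≤ 2 (subst (_≤ m) (x+x≡x*2 x) x+x≤m))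
  where
  x+x≡x*2 : ∀ x → x + x ≡ x * 2
  x+x≡x*2 = solve-∀

foldr-⊔-upper : ∀ {A : Set} (h : A → ℕ) xs {v} → v ∈ xs → h v ≤ foldr _⊔_ 0 (map h xs)
foldr-⊔-upper h (x ∷ xs) (here refl) = m≤m⊔n (h x) _
foldr-⊔-upper h (x ∷ xs) (there v∈xs) = m≤n⇒m≤o⊔n (h x) (foldr-⊔-upper h xs v∈xs)

foldr-⊔-least : ∀ {A : Set} (h : A → ℕ) xs {b} → (∀ v → h v ≤ b) → foldr _⊔_ 0 (map h xs) ≤ b
foldr-⊔-least h [] h≤b = z≤n
foldr-⊔-least h (x ∷ xs) h≤b = ⊔-lub (h≤b x) (foldr-⊔-least h xs h≤b)

≤-sum-map : ∀ {A : Set} (h : A → ℕ) xs {v} → v ∈ xs → h v ≤ sum (map h xs)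
≤-sum-map h (x ∷ xs) (here refl) = m≤m+n (h x) _
≤-sum-map h (x ∷ xs) (there v∈xs) = ≤-trans (≤-sum-map h xs v∈xs) (m≤n+m _ (h x))

partialSum : (ℕ → ℕ) → ℕ → ℕ
partialSum h zero = 0
partialSum h (suc e) = partialSum h e + h e

partialSum-suc : ∀ h e → partialSum h (suc e) ≡ h 0 + partialSum (λ x → h (suc x)) e
partialSum-suc h zero = sym (+-identityʳ (h 0))
partialSum-suc h (suc e) =
  trans (cong (_+ h (suc e)) (partialSum-suc h e)) (+-assoc (h 0) _ (h (suc e)))

sum-tabulate : ∀ m (g : Fin m → ℕ) (h : ℕ → ℕ) → (∀ i → h (toℕ i) ≡ g i) →
  sum (tabulate g) ≡ partialSum h m
sum-tabulate zero g h h≗g = refl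
sum-tabulate (suc m) g h h≗g = trans
  (cong₂ _+_ (sym (h≗g fzero)) (sum-tabulate m (λ i → g (fsuc i)) (λ x → h (suc x)) (λ i → h≗g (fsuc i))))
  (sym (partialSum-suc h m))

sum-tabulate-zero : ∀ m → sum (tabulate {n = m} (λ _ → 0)) ≡ 0
sum-tabulate-zero zero = refl
sum-tabulate-zero (suc m) = sum-tabulate-zero m

Within : ℕ → ℕ → ℕ → Set
Within r x y = x ≤ y + r × y ≤ x + r

within-mono : ∀ {r s x y} → r ≤ s → Within r x y → Within s x y
within-mono {x = x} {y} r≤s (x≤ , y≤) = ≤-trans x≤ (+-monoʳ-≤ y r≤s) , ≤-trans y≤ (+-monoʳ-≤ x r≤s)

within-+ : ∀ x {a b r} → a ≤ b + r → b ≤ a + r → Within r (x + a) (x + b)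
within-+ x {a} {b} {r} a≤ b≤ =
  subst (x + a ≤_) (sym (+-assoc x b r)) (+-monoʳ-≤ x a≤) ,
  subst (x + b ≤_) (sym (+-assoc x a r)) (+-monoʳ-≤ x b≤)

within-right : ∀ {r x y} → x + r ≡ y → Within r x y
within-right {r} {x} {y} eq = ≤-trans (≤-offset r eq) (m≤m+n y r) , subst (_≤ x + r) eq ≤-refl

within-left : ∀ {r x y} → y + r ≡ x → Within r x y
within-left {r} {x} {y} eq = subst (_≤ y + r) eq ≤-refl , ≤-trans (≤-offset r eq) (m≤m+n x r)

pbValue : ℕ → ℕ → ℕ
pbValue 0 q = 2 * q
pbValue 1 q = 2 * q + 1
pbValue 2 q = 2 * q + 1
pbValue 3 q = 2 * q + 1
pbValue _ q = 2 * q + 2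

pbFormulaAux-suc : ∀ N r → pbFormulaAux N (suc r) ≡ pbValue (suc r) (N / 8)
pbFormulaAux-suc N 0 = refl
pbFormulaAux-suc N 1 = refl
pbFormulaAux-suc N 2 = refl
pbFormulaAux-suc N (suc (suc (suc r))) = refl

pbFormula≡pbValue : ∀ N → pbFormula N ≡ pbValue (N % 8) (N / 8)
pbFormula≡pbValue N with N % 8 in N%8≡
... | suc r = pbFormulaAux-suc N r
... | zero = begin
  N / 4                   ≡⟨ /-congˡ N≡8q ⟩
  2 * (N / 8) * 4 / 4     ≡⟨ m*n/n≡m (2 * (N / 8)) 4 ⟩
  2 * (N / 8)             ∎
  where
  open ≡-Reasoning
  8q≡2q*4 : ∀ q → 0 + q * 8 ≡ 2 * q * 4
  8q≡2q*4 = solve-∀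
  N≡8q : N ≡ 2 * (N / 8) * 4
  N≡8q = trans (m≡m%n+[m/n]*n N 8) (trans (cong (_+ N / 8 * 8) N%8≡) (8q≡2q*4 (N / 8)))

pbFormula-residue : ∀ q r → r < 8 → pbFormula (r + q * 8) ≡ pbValue r q
pbFormula-residue q r r<8 =
  trans (pbFormula≡pbValue (r + q * 8))
        (cong₂ pbValue (trans ([m+kn]%n≡m%n r q 8) (m<n⇒m%n≡m r<8)) ([m+kn]/n≡k q 8 r<8))

-- pbFormula N is the least K with Admissible N K.
Admissible : ℕ → ℕ → Set
Admissible N K = N < 4 * K ⊎ (N ≤ 4 * K × 2 ∣ K)

admissible⇒≤ : ∀ {N K} → Admissible N K → N ≤ 4 * K
admissible⇒≤ (inj₁ N<4K) = <⇒≤ N<4K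
admissible⇒≤ (inj₂ (N≤4K , _)) = N≤4K

2∤2q+1 : ∀ q → ¬ (2 ∣ 2 * q + 1)
2∤2q+1 q 2∣ = 1+n≢0 (begin
  1                    ≡⟨ sym ([m+kn]%n≡m%n 1 q 2) ⟩
  (1 + q * 2) % 2      ≡⟨ cong (_% 2) (odd-form q) ⟩
  (2 * q + 1) % 2      ≡⟨ n∣m⇒m%n≡0 _ 2 2∣ ⟩
  0                    ∎)
  where
  open ≡-Reasoning
  odd-form : ∀ q → 1 + q * 2 ≡ 2 * q + 1
  odd-form = solve-∀

pbValue-least-odd : ∀ q r K → 1 ≤ r → Admissible (r + q * 8) K → 2 * q + 1 ≤ K
pbValue-least-odd q r K 1≤r adm = subst (_≤ K) (+-comm 1 (2 * q)) (*-cancelˡ-< 4 (2 * q) K (begin-strict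
  4 * (2 * q)    ≡⟨ 8q q ⟩
  0 + q * 8      <⟨ +-monoˡ-< (q * 8) 1≤r ⟩
  r + q * 8      ≤⟨ admissible⇒≤ adm ⟩
  4 * K          ∎))
  where
  open ≤-Reasoning
  8q : ∀ q → 4 * (2 * q) ≡ 0 + q * 8
  8q = solve-∀

pbValue-least-even : ∀ q r K → 4 ≤ r → Admissible (r + q * 8) K → 2 * q + 2 ≤ K
pbValue-least-even q r K 4≤r adm = subst (_≤ K) (succ q) (lt adm)
  where
  succ : ∀ q → suc (2 * q + 1) ≡ 2 * q + 2
  succ = solve-∀
  8q+4 : ∀ q → 4 * (2 * q + 1) ≡ 4 + q * 8
  8q+4 = solve-∀
  4[2q+1]≤N : 4 * (2 * q + 1) ≤ r + q * 8
  4[2q+1]≤N = subst (_≤ r + q * 8) (sym (8q+4 q)) (+-monoˡ-≤ (q * 8) 4≤r)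
  lt : Admissible (r + q * 8) K → 2 * q + 1 < K
  lt (inj₁ N<4K) = *-cancelˡ-< 4 (2 * q + 1) K (≤-<-trans 4[2q+1]≤N N<4K)
  lt (inj₂ (N≤4K , 2∣K)) =
    ≤∧≢⇒< (*-cancelˡ-≤ 4 (≤-trans 4[2q+1]≤N N≤4K)) (λ eq → 2∤2q+1 q (subst (2 ∣_) (sym eq) 2∣K))

pbValue-least : ∀ q r K → r < 8 → Admissible (r + q * 8) K → pbValue r q ≤ K
pbValue-least q 0 K _ adm = *-cancelˡ-≤ 4 (subst (_≤ 4 * K) (8q q) (admissible⇒≤ adm))
  where
  8q : ∀ q → 0 + q * 8 ≡ 4 * (2 * q)
  8q = solve-∀
pbValue-least q 1 K _ adm = pbValue-least-odd q 1 K (s≤s z≤n) adm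
pbValue-least q 2 K _ adm = pbValue-least-odd q 2 K (s≤s z≤n) adm
pbValue-least q 3 K _ adm = pbValue-least-odd q 3 K (s≤s z≤n) adm
pbValue-least q r@(suc (suc (suc (suc _)))) K _ adm = pbValue-least-even q r K (s≤s (s≤s (s≤s (s≤s z≤n)))) adm

pbFormula-least : ∀ N K → Admissible N K → pbFormula N ≤ K
pbFormula-least N K adm = subst (_≤ K) (sym (pbFormula≡pbValue N))
  (pbValue-least (N / 8) (N % 8) K (m%n<n N 8) (subst (λ M → Admissible M K) (m≡m%n+[m/n]*n N 8) adm))

pbValue-half : ∀ q r → 3 ≤ r + q * 8 → 2 * pbValue r q ≤ r + q * 8
pbValue-half q 0 _ = ≤-offset (4 * q) (eq q)
  where
  eq : ∀ q → 2 * (2 * q) + 4 * q ≡ 0 + q * 8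
  eq = solve-∀
pbValue-half zero 1 (s≤s ())
pbValue-half (suc q) 1 _ = ≤-offset (4 * q + 3) (eq q)
  where
  eq : ∀ q → 2 * (2 * suc q + 1) + (4 * q + 3) ≡ 1 + suc q * 8
  eq = solve-∀
pbValue-half q 2 _ = ≤-offset (4 * q) (eq q)
  where
  eq : ∀ q → 2 * (2 * q + 1) + 4 * q ≡ 2 + q * 8
  eq = solve-∀
pbValue-half q 3 _ = ≤-offset (4 * q + 1) (eq q)
  where
  eq : ∀ q → 2 * (2 * q + 1) + (4 * q + 1) ≡ 3 + q * 8
  eq = solve-∀
pbValue-half q (suc (suc (suc (suc r)))) _ = ≤-offset (4 * q + r) (eq q r)
  where
  eq : ∀ q r → 2 * (2 * q + 2) + (4 * q + r) ≡ 4 + r + q * 8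
  eq = solve-∀

pbFormula-half : ∀ N → 3 ≤ N → 2 * pbFormula N ≤ N
pbFormula-half N 3≤N = subst₂ _≤_ (cong (2 *_) (sym (pbFormula≡pbValue N))) (sym N≡)
  (pbValue-half (N / 8) (N % 8) (subst (3 ≤_) N≡ 3≤N))
  where
  N≡ : N ≡ N % 8 + N / 8 * 8
  N≡ = m≡m%n+[m/n]*n N 8

-- Cyclic gap sequences

OneIsZero : ℕ → ℕ → Set
OneIsZero x y = x ≡ 0 ⊎ y ≡ 0

lastOr : ℕ → List ℕ → ℕ
lastOr x [] = x
lastOr x (y ∷ ys) = lastOr y ys

ones : List ℕ → ℕ
ones [] = 0
ones (0 ∷ xs) = ones xs
ones (1 ∷ xs) = suc (ones xs)
ones (suc (suc _) ∷ xs) = ones xs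

-- weight g ≥ 2 * g, strictly for g = 1, and two adjacent gaps (one of them 0) weigh at most 4.
weight : ℕ → ℕ
weight 0 = 0
weight 1 = 3
weight (suc (suc _)) = 4

weight≤4 : ∀ x → weight x ≤ 4
weight≤4 0 = z≤n
weight≤4 1 = s≤s (s≤s (s≤s z≤n))
weight≤4 (suc (suc x)) = ≤-refl

weight-pair : ∀ {x y} → OneIsZero x y → weight x + weight y ≤ 4
weight-pair {y = y} (inj₁ refl) = weight≤4 y
weight-pair {x} (inj₂ refl) = subst (_≤ 4) (sym (+-identityʳ (weight x))) (weight≤4 x)

sum-weight : ∀ {xs} → All (_≤ 2) xs → sum (map weight xs) ≡ 2 * sum xs + ones xs
sum-weight [] = refl
sum-weight {0 ∷ xs} (_ ∷ xs≤2) = sum-weight xs≤2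
sum-weight {1 ∷ xs} (_ ∷ xs≤2) = trans (cong (3 +_) (sum-weight xs≤2)) (eq (sum xs) (ones xs))
  where
  eq : ∀ s o → 3 + (2 * s + o) ≡ 2 * (1 + s) + suc o
  eq = solve-∀
sum-weight {2 ∷ xs} (_ ∷ xs≤2) = trans (cong (4 +_) (sum-weight xs≤2)) (eq (sum xs) (ones xs))
  where
  eq : ∀ s o → 4 + (2 * s + o) ≡ 2 * (2 + s) + o
  eq = solve-∀
sum-weight {suc (suc (suc _)) ∷ _} (s≤s (s≤s ()) ∷ _)

even-sum : ∀ {xs} → All (_≤ 2) xs → ones xs ≡ 0 → 2 ∣ sum xs
even-sum [] _ = divides 0 refl
even-sum {0 ∷ xs} (_ ∷ xs≤2) no1 = even-sum xs≤2 no1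
even-sum {2 ∷ xs} (_ ∷ xs≤2) no1 = ∣m∣n⇒∣m+n n∣n (even-sum xs≤2 no1)
even-sum {suc (suc (suc _)) ∷ _} (s≤s (s≤s ()) ∷ _) _

sum-weight-linked : ∀ x xs → Linked OneIsZero (x ∷ xs) →
  2 * sum (map weight (x ∷ xs)) + 4 ≤ 4 * length (x ∷ xs) + weight x + weight (lastOr x xs)
sum-weight-linked x [] [-] = ≤-offset 0 (eq (weight x))
  where
  eq : ∀ w → 2 * (w + 0) + 4 + 0 ≡ 4 * 1 + w + w
  eq = solve-∀
sum-weight-linked x (y ∷ ys) (xy ∷ linked) = begin
  2 * (wx + W) + 4                     ≡⟨ eq₁ wx W ⟩
  2 * wx + (2 * W + 4)                 ≤⟨ +-monoʳ-≤ (2 * wx) (sum-weight-linked y ys linked) ⟩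
  2 * wx + (4 * m + weight y + wz)     ≡⟨ eq₂ wx (weight y) m wz ⟩
  (wx + weight y) + (wx + (4 * m + wz)) ≤⟨ +-monoˡ-≤ (wx + (4 * m + wz)) (weight-pair xy) ⟩
  4 + (wx + (4 * m + wz))              ≡⟨ eq₃ wx m wz ⟩
  4 * suc m + wx + wz                  ∎
  where
  open ≤-Reasoning
  wx = weight x
  W = sum (map weight (y ∷ ys))
  m = length (y ∷ ys)
  wz = weight (lastOr y ys)
  eq₁ : ∀ a s → 2 * (a + s) + 4 ≡ 2 * a + (2 * s + 4)
  eq₁ = solve-∀
  eq₂ : ∀ a b l z → 2 * a + (4 * l + b + z) ≡ (a + b) + (a + (4 * l + z))
  eq₂ = solve-∀
  eq₃ : ∀ a l z → 4 + (a + (4 * l + z)) ≡ 4 * suc l + a + z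
  eq₃ = solve-∀

sum-weight-cyclic : ∀ x xs → Linked OneIsZero (x ∷ xs) → OneIsZero x (lastOr x xs) →
  sum (map weight (x ∷ xs)) ≤ 2 * length (x ∷ xs)
sum-weight-cyclic x xs linked wrap = *-cancelˡ-≤ 2 (subst (2 * W ≤_) (eq m) (+-cancelʳ-≤ 4 (2 * W) (4 * m) (begin
  2 * W + 4                            ≤⟨ sum-weight-linked x xs linked ⟩
  4 * m + weight x + weight (lastOr x xs) ≡⟨ +-assoc (4 * m) _ _ ⟩
  4 * m + (weight x + weight (lastOr x xs)) ≤⟨ +-monoʳ-≤ (4 * m) (weight-pair wrap) ⟩
  4 * m + 4                            ∎)))
  where
  open ≤-Reasoning
  W = sum (map weight (x ∷ xs))
  m = length (x ∷ xs)
  eq : ∀ m → 4 * m ≡ 2 * (2 * m)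
  eq = solve-∀

cyclic-gaps : ∀ x xs → All (_≤ 2) (x ∷ xs) → Linked OneIsZero (x ∷ xs) → OneIsZero x (lastOr x xs) →
  sum (x ∷ xs) < length (x ∷ xs) ⊎ (sum (x ∷ xs) ≤ length (x ∷ xs) × 2 ∣ sum (x ∷ xs))
cyclic-gaps x xs ≤2 linked wrap = by-ones (ones (x ∷ xs)) refl
  where
  s = sum (x ∷ xs)
  m = length (x ∷ xs)
  2s+o≤2m : 2 * s + ones (x ∷ xs) ≤ 2 * m
  2s+o≤2m = subst (_≤ 2 * m) (sum-weight ≤2) (sum-weight-cyclic x xs linked wrap)
  by-ones : ∀ o → ones (x ∷ xs) ≡ o → s < m ⊎ (s ≤ m × 2 ∣ s)
  by-ones zero o≡0 = inj₂ (*-cancelˡ-≤ 2 (≤-trans (m≤m+n (2 * s) _) 2s+o≤2m) , even-sum ≤2 o≡0)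
  by-ones (suc _) o≡ = inj₁ (*-cancelˡ-< 2 s m (<-≤-trans (m<m+n (2 * s) (subst (0 <_) (sym o≡) z<s)) 2s+o≤2m))

2K+a+b≤4K : ∀ {K a b} → a ≤ K → b ≤ K → 2 * K + a + b ≤ 4 * K
2K+a+b≤4K {K} a≤K b≤K = ≤-trans (+-mono-≤ (+-monoʳ-≤ (2 * K) a≤K) b≤K) (≤-reflexive (eq K))
  where
  eq : ∀ K → 2 * K + K + K ≡ 4 * K
  eq = solve-∀

admissible-from-gaps : ∀ {N K m P} → N ≡ 2 * K + m + P → m ≤ K → P < m ⊎ (P ≤ m × 2 ∣ P) → Admissible N K
admissible-from-gaps {K = K} {m} refl m≤K (inj₁ P<m) =
  inj₁ (<-≤-trans (+-monoʳ-< (2 * K + m) P<m) (2K+a+b≤4K m≤K m≤K))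
admissible-from-gaps {K = K} {m} refl m≤K (inj₂ (P≤m , 2∣P)) with m≤n⇒m<n∨m≡n P≤m | m≤n⇒m<n∨m≡n m≤K
... | inj₁ P<m | _ = admissible-from-gaps refl m≤K (inj₁ P<m)
... | inj₂ refl | inj₁ m<K = inj₁ (<-≤-trans (+-monoʳ-< (2 * K + m) m<K) (2K+a+b≤4K m≤K ≤-refl))
... | inj₂ refl | inj₂ refl = inj₂ (2K+a+b≤4K {K} ≤-refl ≤-refl , 2∣P)

-- Binary words

true≢false : true ≢ false
true≢false ()

bit : Bool → ℕ
bit true = 1
bit false = 0

popcount : List Bool → ℕ
popcount w = sum (map bit w)

bitAt : List Bool → ℕ → Bool
bitAt [] _ = false
bitAt (b ∷ w) zero = b
bitAt (b ∷ w) (suc i) = bitAt w i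

bitAt-++ˡ : ∀ u v {i} → i < length u → bitAt (u ++ v) i ≡ bitAt u i
bitAt-++ˡ (b ∷ u) v {zero} _ = refl
bitAt-++ˡ (b ∷ u) v {suc i} (s≤s i<u) = bitAt-++ˡ u v i<u

bitAt-++ʳ : ∀ u v i → bitAt (u ++ v) (length u + i) ≡ bitAt v i
bitAt-++ʳ [] v i = refl
bitAt-++ʳ (b ∷ u) v i = bitAt-++ʳ u v i

bitAt-take : ∀ m w {i} → i < m → bitAt (take m w) i ≡ bitAt w i
bitAt-take (suc m) [] _ = refl
bitAt-take (suc m) (b ∷ w) {zero} _ = refl
bitAt-take (suc m) (b ∷ w) {suc i} (s≤s i<m) = bitAt-take m w i<m

partialSum-popcount : ∀ w → partialSum (λ i → bit (bitAt w i)) (length w) ≡ popcount w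
partialSum-popcount [] = refl
partialSum-popcount (b ∷ w) =
  trans (partialSum-suc (λ i → bit (bitAt (b ∷ w) i)) (length w)) (cong (bit b +_) (partialSum-popcount w))

-- Read at the centre a₃: a 1 is followed by two 0s and has a 1 at distance 3, so 1s are at least
-- 3 apart and cannot grow to strength 2; a 0 has a 1 within distance 2, so it cannot start broadcasting.
goodWindow : Bool → Bool → Bool → Bool → Bool → Bool → Bool → Bool
goodWindow a₀ a₁ a₂ a₃ a₄ a₅ a₆ =
  (not a₃ ∨ (not a₄ ∧ not a₅)) ∧ ((a₃ ∨ (a₄ ∨ (a₅ ∨ (a₂ ∨ a₁)))) ∧ (not a₃ ∨ (a₆ ∨ a₀)))

allWindows : List Bool → Bool
allWindows (a₀ ∷ a₁ ∷ a₂ ∷ a₃ ∷ a₄ ∷ a₅ ∷ a₆ ∷ w) =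
  goodWindow a₀ a₁ a₂ a₃ a₄ a₅ a₆ ∧ allWindows (a₁ ∷ a₂ ∷ a₃ ∷ a₄ ∷ a₅ ∷ a₆ ∷ w)
allWindows _ = true

Window : (ℕ → Bool) → ℕ → Set
Window b i = T (goodWindow (b (i + 0)) (b (i + 1)) (b (i + 2)) (b (i + 3)) (b (i + 4)) (b (i + 5)) (b (i + 6)))

window-cong : ∀ {b c i i′} → (∀ j → j ≤ 6 → b (i + j) ≡ c (i′ + j)) → Window b i → Window c i′
window-cong eq window
  rewrite sym (eq 0 (≤ᵇ⇒≤ 0 6 tt)) | sym (eq 1 (≤ᵇ⇒≤ 1 6 tt)) | sym (eq 2 (≤ᵇ⇒≤ 2 6 tt))
        | sym (eq 3 (≤ᵇ⇒≤ 3 6 tt)) | sym (eq 4 (≤ᵇ⇒≤ 4 6 tt)) | sym (eq 5 (≤ᵇ⇒≤ 5 6 tt))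
        | sym (eq 6 (≤ᵇ⇒≤ 6 6 tt)) = window

windowAt : ∀ w i → T (allWindows w) → 7 + i ≤ length w → Window (bitAt w) i
windowAt (a₀ ∷ a₁ ∷ a₂ ∷ a₃ ∷ a₄ ∷ a₅ ∷ a₆ ∷ w) zero all _ = proj₁ (Equivalence.to T-∧ all)
windowAt (a₀ ∷ a₁ ∷ a₂ ∷ a₃ ∷ a₄ ∷ a₅ ∷ a₆ ∷ w) (suc i) all (s≤s 7+i≤) =
  windowAt (a₁ ∷ a₂ ∷ a₃ ∷ a₄ ∷ a₅ ∷ a₆ ∷ w) i (proj₂ (Equivalence.to T-∧ all)) 7+i≤
windowAt [] _ _ ()
windowAt (_ ∷ []) _ _ (s≤s ())
windowAt (_ ∷ _ ∷ []) _ _ (s≤s (s≤s ()))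
windowAt (_ ∷ _ ∷ _ ∷ []) _ _ (s≤s (s≤s (s≤s ())))
windowAt (_ ∷ _ ∷ _ ∷ _ ∷ []) _ _ (s≤s (s≤s (s≤s (s≤s ()))))
windowAt (_ ∷ _ ∷ _ ∷ _ ∷ _ ∷ []) _ _ (s≤s (s≤s (s≤s (s≤s (s≤s ())))))
windowAt (_ ∷ _ ∷ _ ∷ _ ∷ _ ∷ _ ∷ []) _ _ (s≤s (s≤s (s≤s (s≤s (s≤s (s≤s ()))))))

goodWindow-isolated : ∀ a₀ a₁ a₂ a₃ a₄ a₅ a₆ → T (goodWindow a₀ a₁ a₂ a₃ a₄ a₅ a₆) → a₃ ≡ true →
  a₄ ≡ false × a₅ ≡ false
goodWindow-isolated _ _ _ true false false _ _ refl = refl , refl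
goodWindow-isolated _ _ _ true true _ _ () refl
goodWindow-isolated _ _ _ true false true _ () refl

goodWindow-near : ∀ a₀ a₁ a₂ a₃ a₄ a₅ a₆ → T (goodWindow a₀ a₁ a₂ a₃ a₄ a₅ a₆) → a₃ ≡ false →
  a₄ ≡ true ⊎ a₅ ≡ true ⊎ a₂ ≡ true ⊎ a₁ ≡ true
goodWindow-near _ _ _ false true _ _ _ refl = inj₁ refl
goodWindow-near _ _ _ false false true _ _ refl = inj₂ (inj₁ refl)
goodWindow-near _ _ true false false false _ _ refl = inj₂ (inj₂ (inj₁ refl))
goodWindow-near _ true false false false false _ _ refl = inj₂ (inj₂ (inj₂ refl))
goodWindow-near _ false false false false false _ () refl

goodWindow-far : ∀ a₀ a₁ a₂ a₃ a₄ a₅ a₆ → T (goodWindow a₀ a₁ a₂ a₃ a₄ a₅ a₆) → a₃ ≡ true →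
  a₆ ≡ true ⊎ a₀ ≡ true
goodWindow-far _ _ _ true false false true _ refl = inj₁ refl
goodWindow-far true _ _ true false false false _ refl = inj₂ refl
goodWindow-far false _ _ true false false false () refl
goodWindow-far _ _ _ true true _ _ () refl
goodWindow-far _ _ _ true false true _ () refl

prefix : List Bool
prefix = false ∷ true ∷ false ∷ false ∷ true ∷ false ∷ []

blocks : ℕ → List Bool
blocks zero = []
blocks (suc q) = prefix ++ false ∷ false ∷ blocks q

ending : ℕ → List Bool
ending 1 = false ∷ []
ending 2 = false ∷ false ∷ []
ending 3 = false ∷ true ∷ false ∷ []
ending 4 = false ∷ false ∷ true ∷ false ∷ []
ending 5 = false ∷ false ∷ false ∷ true ∷ false ∷ []
ending 6 = false ∷ true ∷ false ∷ false ∷ true ∷ false ∷ []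
ending 7 = false ∷ false ∷ true ∷ false ∷ false ∷ true ∷ false ∷ []
ending _ = []

word : ℕ → ℕ → List Bool
word q r = blocks q ++ prefix ++ ending r

allWindows-blocks : ∀ q v → T (allWindows (prefix ++ v)) → T (allWindows (blocks q ++ prefix ++ v))
allWindows-blocks zero v all = all
allWindows-blocks (suc zero) v all = all
allWindows-blocks (suc (suc q)) v all = allWindows-blocks (suc q) v all

allWindows-closing : ∀ r → r < 8 → T (allWindows (prefix ++ ending r ++ prefix))
allWindows-closing 0 _ = tt
allWindows-closing 1 _ = tt
allWindows-closing 2 _ = tt
allWindows-closing 3 _ = tt
allWindows-closing 4 _ = tt
allWindows-closing 5 _ = tt
allWindows-closing 6 _ = tt
allWindows-closing 7 _ = tt
allWindows-closing (suc (suc (suc (suc (suc (suc (suc (suc _)))))))) (s≤s (s≤s (s≤s (s≤s (s≤s (s≤s (s≤s (s≤s ()))))))))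

take-word : ∀ q r → take 6 (word q r) ≡ prefix
take-word zero r = refl
take-word (suc q) r = refl

word-windows : ∀ q r → r < 8 → T (allWindows (word q r ++ take 6 (word q r)))
word-windows q r r<8 = subst (λ u → T (allWindows (word q r ++ u))) (sym (take-word q r))
  (subst (λ u → T (allWindows u)) (sym (++-assoc (blocks q) (prefix ++ ending r) prefix))
         (allWindows-blocks q (ending r ++ prefix) (allWindows-closing r r<8)))

length-closing : ∀ r → r < 8 → length (prefix ++ ending r) ≡ 6 + r
length-closing 0 _ = refl
length-closing 1 _ = refl
length-closing 2 _ = refl
length-closing 3 _ = refl
length-closing 4 _ = refl
length-closing 5 _ = refl
length-closing 6 _ = refl
length-closing 7 _ = refl
length-closing (suc (suc (suc (suc (suc (suc (suc (suc _)))))))) (s≤s (s≤s (s≤s (s≤s (s≤s (s≤s (s≤s (s≤s ()))))))))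

length-blocks : ∀ q → length (blocks q) ≡ q * 8
length-blocks zero = refl
length-blocks (suc q) = cong (8 +_) (length-blocks q)

length-word : ∀ q r → r < 8 → length (word q r) ≡ 6 + r + q * 8
length-word q r r<8 = begin
  length (blocks q ++ prefix ++ ending r)     ≡⟨ length-++ (blocks q) ⟩
  length (blocks q) + length (prefix ++ ending r) ≡⟨ cong₂ _+_ (length-blocks q) (length-closing r r<8) ⟩
  q * 8 + (6 + r)                             ≡⟨ +-comm (q * 8) (6 + r) ⟩
  6 + r + q * 8                               ∎
  where open ≡-Reasoning

popcount-++ : ∀ u v → popcount (u ++ v) ≡ popcount u + popcount v
popcount-++ u v = trans (cong sum (map-++ bit u v)) (sum-++ (map bit u) (map bit v))

popcount-blocks : ∀ q → popcount (blocks q) ≡ 2 * q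
popcount-blocks zero = refl
popcount-blocks (suc q) = trans (cong (2 +_) (popcount-blocks q)) (sym (*-suc 2 q))

2[1+q]+c : ∀ q c → 2 * suc q + c ≡ 2 * q + (2 + c)
2[1+q]+c = solve-∀

pbFormula-closing : ∀ q r → r < 8 → pbFormula (6 + r + q * 8) ≡ 2 * q + popcount (prefix ++ ending r)
pbFormula-closing q 0 _ = pbFormula-residue q 6 (<ᵇ⇒< 6 8 tt)
pbFormula-closing q 1 _ = pbFormula-residue q 7 (<ᵇ⇒< 7 8 tt)
pbFormula-closing q 2 _ = trans (pbFormula-residue (suc q) 0 (<ᵇ⇒< 0 8 tt)) (trans (sym (+-identityʳ _)) (2[1+q]+c q 0))
pbFormula-closing q 3 _ = trans (pbFormula-residue (suc q) 1 (<ᵇ⇒< 1 8 tt)) (2[1+q]+c q 1)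
pbFormula-closing q 4 _ = trans (pbFormula-residue (suc q) 2 (<ᵇ⇒< 2 8 tt)) (2[1+q]+c q 1)
pbFormula-closing q 5 _ = trans (pbFormula-residue (suc q) 3 (<ᵇ⇒< 3 8 tt)) (2[1+q]+c q 1)
pbFormula-closing q 6 _ = trans (pbFormula-residue (suc q) 4 (<ᵇ⇒< 4 8 tt)) (2[1+q]+c q 2)
pbFormula-closing q 7 _ = trans (pbFormula-residue (suc q) 5 (<ᵇ⇒< 5 8 tt)) (2[1+q]+c q 2)
pbFormula-closing q (suc (suc (suc (suc (suc (suc (suc (suc _)))))))) (s≤s (s≤s (s≤s (s≤s (s≤s (s≤s (s≤s (s≤s ()))))))))

pbFormula-word : ∀ q r → r < 8 → pbFormula (6 + r + q * 8) ≡ popcount (word q r)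
pbFormula-word q r r<8 = begin
  pbFormula (6 + r + q * 8)                           ≡⟨ pbFormula-closing q r r<8 ⟩
  2 * q + popcount (prefix ++ ending r)               ≡⟨ cong (_+ popcount (prefix ++ ending r)) (popcount-blocks q) ⟨
  popcount (blocks q) + popcount (prefix ++ ending r) ≡⟨ popcount-++ (blocks q) (prefix ++ ending r) ⟨
  popcount (word q r)                                 ∎
  where open ≡-Reasoning

-- The cycle and its cover ℕ

module Cycle (k : ℕ) where

  n : ℕ
  n = 3 + k

  open Broadcasts n (cycleDist n)

  d : Fin n → Fin n → ℕ
  d = cycleDist n

  vertex : ℕ → Fin n
  vertex x = fromℕ< (m%n<n x n)

  toℕ-vertex : ∀ x → toℕ (vertex x) ≡ x % n
  toℕ-vertex x = toℕ-fromℕ< (m%n<n x n)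

  toℕ-vertex-< : ∀ {x} → x < n → toℕ (vertex x) ≡ x
  toℕ-vertex-< {x} x<n = trans (toℕ-vertex x) (m<n⇒m%n≡m x<n)

  vertex-toℕ : ∀ v → vertex (toℕ v) ≡ v
  vertex-toℕ v = toℕ-injective (toℕ-vertex-< (toℕ<n v))

  vertex-+kn : ∀ v t → vertex (toℕ v + t * n) ≡ v
  vertex-+kn v t = toℕ-injective (trans (toℕ-vertex (toℕ v + t * n))
                                        (trans ([m+kn]%n≡m%n (toℕ v) t n) (m<n⇒m%n≡m (toℕ<n v))))

  %-≡⇒vertex-≡ : ∀ {x y} → x % n ≡ y % n → vertex x ≡ vertex y
  %-≡⇒vertex-≡ {x} {y} eq = toℕ-injective (trans (toℕ-vertex x) (trans eq (sym (toℕ-vertex y))))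

  vertex-≡⇒%-≡ : ∀ {x y} → vertex x ≡ vertex y → x % n ≡ y % n
  vertex-≡⇒%-≡ {x} {y} eq = trans (sym (toℕ-vertex x)) (trans (cong toℕ eq) (toℕ-vertex y))

  vertex-+n : ∀ x → vertex (x + n) ≡ vertex x
  vertex-+n x = %-≡⇒vertex-≡ {x + n} {x} ([m+n]%n≡m%n x n)

  %-injective-window : ∀ x y → x % n ≡ y % n → x ≤ y → y < x + n → x ≡ y
  %-injective-window x y eq x≤y y<x+n = begin
    x                   ≡⟨ m≡m%n+[m/n]*n x n ⟩
    x % n + x / n * n   ≡⟨ cong₂ (λ a b → a + b * n) eq x/n≡y/n ⟩
    y % n + y / n * n   ≡⟨ m≡m%n+[m/n]*n y n ⟨
    y                   ∎
    where
    open ≡-Reasoning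
    x≡ : x ≡ y % n + x / n * n
    x≡ = trans (m≡m%n+[m/n]*n x n) (cong (_+ x / n * n) eq)
    ≤y/n : x / n * n ≤ y / n * n
    ≤y/n = +-cancelˡ-≤ (y % n) _ _ (subst₂ _≤_ x≡ (m≡m%n+[m/n]*n y n) x≤y)
    y/n< : y / n * n < suc (x / n) * n
    y/n< = +-cancelˡ-< (y % n) _ _ (subst₂ _<_ (m≡m%n+[m/n]*n y n)
             (trans (cong (_+ n) x≡) (trans (+-assoc (y % n) _ n) (cong (y % n +_) (+-comm _ n)))) y<x+n)
    x/n≡y/n : x / n ≡ y / n
    x/n≡y/n = ≤-antisym (*-cancelʳ-≤ _ _ n ≤y/n) (s≤s⁻¹ (*-cancelʳ-< n _ _ y/n<))

  vertex-+-injective : ∀ x {i j} → i < j → j < i + n → vertex (x + i) ≢ vertex (x + j)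
  vertex-+-injective x {i} {j} i<j j< eq = <-irrefl (+-cancelˡ-≡ x i j
    (%-injective-window (x + i) (x + j) (vertex-≡⇒%-≡ {x + i} {x + j} eq) (+-monoʳ-≤ x (<⇒≤ i<j))
                        (subst (x + j <_) (sym (+-assoc x i n)) (+-monoʳ-< x j<)))) i<j

  d-sym : ∀ u v → d u v ≡ d v u
  d-sym u v rewrite ∣-∣-comm (toℕ u) (toℕ v) = refl

  d-refl : ∀ v → d v v ≡ 0
  d-refl v rewrite ∣n-n∣≡0 (toℕ v) = refl

  d≤n : ∀ u v → d u v ≤ n
  d≤n u v = ≤-trans (m⊓n≤n ∣ toℕ u - toℕ v ∣ _) (m∸n≤m n ∣ toℕ u - toℕ v ∣)

  d-toℕ : ∀ u v {i j} → toℕ u ≡ i → toℕ v ≡ j → d u v ≡ ∣ i - j ∣ ⊓ (n ∸ ∣ i - j ∣)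
  d-toℕ u v refl refl = refl

  d-vertex-≤-base : ∀ r x y → x < n → x ≤ y → y ≤ x + r → d (vertex x) (vertex y) ≤ r
  d-vertex-≤-base r x y x<n x≤y y≤ with y <? n
  ... | yes y<n = subst (_≤ r) (sym (d-toℕ (vertex x) (vertex y) (toℕ-vertex-< x<n) (toℕ-vertex-< y<n)))
        (≤-trans (m⊓n≤m ∣ x - y ∣ _) (subst (_≤ r) (sym (m≤n⇒∣m-n∣≡n∸m x≤y)) (m≤n+o⇒m∸n≤o y x y≤)))
  ... | no y≮n with n ≤? r
  ...   | yes n≤r = ≤-trans (d≤n (vertex x) (vertex y)) n≤r
  ...   | no n≰r = subst (_≤ r) (sym (d-toℕ (vertex x) (vertex y) (toℕ-vertex-< x<n) toℕ-vertex-y))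
                     (≤-trans (m⊓n≤n ∣ x - y′ ∣ _) around)
    where
    -- y lies beyond the end of [0, n): it is the vertex y′ = y - n < x, reached around the cycle.
    y′ = y ∸ n
    y′+n : y′ + n ≡ y
    y′+n = m∸n+n≡m (≮⇒≥ y≮n)
    y′<x : y′ < x
    y′<x = +-cancelʳ-< n y′ x (subst (_< x + n) (sym y′+n) (≤-<-trans y≤ (+-monoʳ-< x (≰⇒> n≰r))))
    toℕ-vertex-y : toℕ (vertex y) ≡ y′
    toℕ-vertex-y = trans (cong toℕ (trans (cong vertex (sym y′+n)) (vertex-+n y′)))
                         (toℕ-vertex-< (<-trans y′<x x<n))
    around : n ∸ ∣ x - y′ ∣ ≤ r
    around = subst (λ z → n ∸ z ≤ r) (sym (m≤n⇒∣n-m∣≡n∸m (<⇒≤ y′<x)))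
      (m≤n+o⇒m∸n≤o n (x ∸ y′) (+-cancelˡ-≤ y′ _ _ (subst₂ _≤_ (sym y′+n)
        (trans (cong (_+ r) (sym (m+[n∸m]≡n (<⇒≤ y′<x)))) (+-assoc y′ _ r)) y≤)))

  d-vertex-≤-ordered : ∀ r x y → x ≤ y → y ≤ x + r → d (vertex x) (vertex y) ≤ r
  d-vertex-≤-ordered r x y x≤y y≤ =
    subst₂ (λ a b → d a b ≤ r) (%-≡⇒vertex-≡ {x₀} {x} x₀%) (%-≡⇒vertex-≡ {y₀} {y} y₀%)
    (d-vertex-≤-base r x₀ y₀ (m%n<n x n) (+-cancelʳ-≤ t x₀ y₀ (subst₂ _≤_ x≡ y≡ x≤y))
      (+-cancelʳ-≤ t y₀ (x₀ + r) (subst₂ _≤_ y≡ (trans (cong (_+ r) x≡) (eq x₀ t r)) y≤)))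
    where
    t = x / n * n
    x₀ = x % n
    y₀ = y ∸ t
    x≡ : x ≡ x₀ + t
    x≡ = m≡m%n+[m/n]*n x n
    y≡ : y ≡ y₀ + t
    y≡ = sym (m∸n+n≡m (≤-trans (m/n*n≤m x n) x≤y))
    x₀% : x₀ % n ≡ x % n
    x₀% = trans (sym ([m+kn]%n≡m%n x₀ (x / n) n)) (cong (_% n) (sym x≡))
    y₀% : y₀ % n ≡ y % n
    y₀% = trans (sym ([m+kn]%n≡m%n y₀ (x / n) n)) (cong (_% n) (sym y≡))
    eq : ∀ a t r → a + t + r ≡ a + r + t
    eq = solve-∀

  d-vertex-≤ : ∀ {r x y} → Within r x y → d (vertex x) (vertex y) ≤ r
  d-vertex-≤ {r} {x} {y} (x≤ , y≤) with ≤-total x y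
  ... | inj₁ x≤y = d-vertex-≤-ordered r x y x≤y y≤
  ... | inj₂ y≤x = subst (_≤ r) (d-sym (vertex y) (vertex x)) (d-vertex-≤-ordered r y x y≤x x≤)

  Lift : ℕ → Fin n → Set
  Lift u c = Σ ℕ λ c′ → vertex c′ ≡ c × Within (d (vertex u) c) u c′

  lift-forward : ∀ u q c → u ≡ u % n + suc q * n → u % n ≤ toℕ c → Lift u c
  lift-forward u q c u≡ i≤j = shorter (e ≤? n ∸ e)
    where
    i = u % n
    e = toℕ c ∸ i
    d≡ : d (vertex u) c ≡ e ⊓ (n ∸ e)
    d≡ = trans (d-toℕ (vertex u) c (toℕ-vertex u) refl) (cong (λ z → z ⊓ (n ∸ z)) (m≤n⇒∣m-n∣≡n∸m i≤j))
    e+[n∸e] : e + (n ∸ e) ≡ n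
    e+[n∸e] = m+[n∸m]≡n (≤-trans (m∸n≤m (toℕ c) i) (<⇒≤ (toℕ<n c)))
    eq₁ : ∀ i e s → i + s + e ≡ i + e + s
    eq₁ = solve-∀
    eq₂ : ∀ i e q m → i + e + q * (e + m) + m ≡ i + ((e + m) + q * (e + m))
    eq₂ = solve-∀
    shorter : Dec (e ≤ n ∸ e) → Lift u c
    shorter (yes e≤) = toℕ c + suc q * n , vertex-+kn c (suc q) ,
      subst (λ D → Within D u (toℕ c + suc q * n)) (sym (trans d≡ (m≤n⇒m⊓n≡m e≤)))
        (within-right (trans (cong (_+ e) u≡) (trans (eq₁ i e (suc q * n)) (cong (_+ suc q * n) (m+[n∸m]≡n i≤j)))))
    shorter (no e≰) = toℕ c + q * n , vertex-+kn c q ,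
      subst (λ D → Within D u (toℕ c + q * n)) (sym (trans d≡ (m≥n⇒m⊓n≡n (<⇒≤ (≰⇒> e≰)))))
        (within-left (trans (cong (λ z → z + q * n + (n ∸ e)) (sym (m+[n∸m]≡n i≤j)))
          (trans (subst (λ N → i + e + q * N + (n ∸ e) ≡ i + (N + q * N)) e+[n∸e] (eq₂ i e q (n ∸ e)))
                 (sym u≡))))

  lift-backward : ∀ u q c → u ≡ u % n + suc q * n → toℕ c ≤ u % n → Lift u c
  lift-backward u q c u≡ j≤i = shorter (e ≤? n ∸ e)
    where
    j = toℕ c
    e = u % n ∸ j
    d≡ : d (vertex u) c ≡ e ⊓ (n ∸ e)
    d≡ = trans (d-toℕ (vertex u) c (toℕ-vertex u) refl) (cong (λ z → z ⊓ (n ∸ z)) (m≤n⇒∣n-m∣≡n∸m j≤i))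
    e+[n∸e] : e + (n ∸ e) ≡ n
    e+[n∸e] = m+[n∸m]≡n (≤-trans (m∸n≤m (u % n) j) (<⇒≤ (m%n<n u n)))
    eq₁ : ∀ j e s → j + s + e ≡ j + e + s
    eq₁ = solve-∀
    eq₂ : ∀ j e s m → j + e + s + m ≡ j + ((e + m) + s)
    eq₂ = solve-∀
    shorter : Dec (e ≤ n ∸ e) → Lift u c
    shorter (yes e≤) = toℕ c + suc q * n , vertex-+kn c (suc q) ,
      subst (λ D → Within D u (toℕ c + suc q * n)) (sym (trans d≡ (m≤n⇒m⊓n≡m e≤)))
        (within-left (trans (eq₁ j e (suc q * n)) (trans (cong (_+ suc q * n) (m+[n∸m]≡n j≤i)) (sym u≡))))
    shorter (no e≰) = toℕ c + suc (suc q) * n , vertex-+kn c (suc (suc q)) ,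
      subst (λ D → Within D u (toℕ c + suc (suc q) * n)) (sym (trans d≡ (m≥n⇒m⊓n≡n (<⇒≤ (≰⇒> e≰)))))
        (within-right (trans (cong (_+ (n ∸ e)) u≡)
          (trans (cong (λ z → z + suc q * n + (n ∸ e)) (sym (m+[n∸m]≡n j≤i)))
            (trans (eq₂ j e (suc q * n) (n ∸ e)) (cong (λ N → j + (N + suc q * n)) e+[n∸e])))))

  -- n ≤ u leaves room for the copy of c one period below u.
  lift : ∀ u → n ≤ u → (c : Fin n) → Lift u c
  lift u n≤u c with u / n in u/n≡ | ≤-total (u % n) (toℕ c)
  ... | zero | _ = ⊥-elim (<-irrefl (sym u/n≡) (m≥n⇒m/n>0 {u} {n} n≤u))
  ... | suc q | inj₁ i≤j = lift-forward u q c u≡ i≤j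
    where
    u≡ : u ≡ u % n + suc q * n
    u≡ = trans (m≡m%n+[m/n]*n u n) (cong (λ z → u % n + z * n) u/n≡)
  ... | suc q | inj₂ j≤i = lift-backward u q c u≡ j≤i
    where
    u≡ : u ≡ u % n + suc q * n
    u≡ = trans (m≡m%n+[m/n]*n u n) (cong (λ z → u % n + z * n) u/n≡)

  d≤ecc : ∀ v u → d v u ≤ ecc v
  d≤ecc v u = foldr-⊔-upper (d v) (allFin n) (∈-allFin u)

  ecc≤diam : ∀ v → ecc v ≤ diam
  ecc≤diam v = foldr-⊔-upper ecc (allFin n) (∈-allFin v)

  half : ℕ
  half = n / 2

  1≤half : 1 ≤ half
  1≤half = m≥n⇒m/n>0 {n} {2} (s≤s (s≤s z≤n))

  half+half≤n : half + half ≤ n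
  half+half≤n = subst (_≤ n) (trans (*-comm half 2) (cong (half +_) (+-identityʳ half))) (m/n*n≤m n 2)

  d≤half : ∀ u v → d u v ≤ half
  d≤half u v = ≤-half (d u v) n
    (≤-trans (+-mono-≤ (m⊓n≤m a (n ∸ a)) (m⊓n≤n a (n ∸ a))) (≤-reflexive (m+[n∸m]≡n a≤n)))
    where
    a = ∣ toℕ u - toℕ v ∣
    a≤n : a ≤ n
    a≤n = ≤-trans (∣m-n∣≤m⊔n (toℕ u) (toℕ v)) (⊔-lub (<⇒≤ (toℕ<n u)) (<⇒≤ (toℕ<n v)))

  d-antipode : ∀ v → d v (vertex (toℕ v + half)) ≡ half
  d-antipode v with toℕ v + half <? n
  ... | yes i+h<n = trans (d-toℕ v (vertex (toℕ v + half)) refl (toℕ-vertex-< i+h<n))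
                      (trans (cong (λ z → z ⊓ (n ∸ z)) (∣m-m+n∣≡n (toℕ v) half)) (m≤n⇒m⊓n≡m half≤n∸half))
    where
    half≤n∸half : half ≤ n ∸ half
    half≤n∸half = m+n≤o⇒m≤o∸n half half+half≤n
  ... | no i+h≮n = trans (d-toℕ v (vertex (toℕ v + half)) refl toℕ-j) (trans (cong (λ z → z ⊓ (n ∸ z)) ∣i-j∣)
                     (trans (cong ((n ∸ half) ⊓_) (m∸[m∸n]≡n (≤-trans (m≤m+n half half) half+half≤n)))
                            (m≥n⇒m⊓n≡n (m+n≤o⇒m≤o∸n half half+half≤n))))
    where
    i = toℕ v
    j = i + half ∸ n
    j+n : j + n ≡ i + half
    j+n = m∸n+n≡m (≮⇒≥ i+h≮n)
    j<i : j < i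
    j<i = +-cancelʳ-< n j i (subst (_< i + n) (sym j+n) (+-monoʳ-< i (m/n<m n 2 (s≤s (s≤s z≤n)))))
    toℕ-j : toℕ (vertex (i + half)) ≡ j
    toℕ-j = trans (cong toℕ (trans (cong vertex (sym j+n)) (vertex-+n j))) (toℕ-vertex-< (<-trans j<i (toℕ<n v)))
    i≡ : i ≡ j + (n ∸ half)
    i≡ = +-cancelʳ-≡ half i (j + (n ∸ half)) (trans (sym j+n)
           (trans (cong (j +_) (sym (m∸n+n≡m (≤-trans (m≤m+n half half) half+half≤n)))) (sym (+-assoc j _ half))))
    ∣i-j∣ : ∣ i - j ∣ ≡ n ∸ half
    ∣i-j∣ = trans (m≤n⇒∣n-m∣≡n∸m (<⇒≤ j<i)) (trans (cong (_∸ j) i≡) (m+n∸m≡n j (n ∸ half)))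

  half≤ecc : ∀ v → half ≤ ecc v
  half≤ecc v = subst (_≤ ecc v) (d-antipode v) (d≤ecc v (vertex (toℕ v + half)))

  ecc≤half : ∀ v → ecc v ≤ half
  ecc≤half v = foldr-⊔-least (d v) (allFin n) (d≤half v)

  CanRaise : (Fin n → ℕ) → Fin n → ℕ → Set
  CanRaise f z r = ∀ u v → v ≢ z → InH f u v → d u z ≤ r → ⊥

  module Raise (f : Fin n → ℕ) (z : Fin n) (r : ℕ) where

    g : Fin n → ℕ
    g v with v ≟ᶠ z
    ... | yes _ = r
    ... | no _ = f v

    g-cases : ∀ v → (v ≡ z × g v ≡ r) ⊎ (v ≢ z × g v ≡ f v)
    g-cases v with v ≟ᶠ z
    ... | yes v≡z = inj₁ (v≡z , refl)
    ... | no v≢z = inj₂ (v≢z , refl)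

    g-at : g z ≡ r
    g-at with g-cases z
    ... | inj₁ (_ , eq) = eq
    ... | inj₂ (z≢z , _) = ⊥-elim (z≢z refl)

    g≥f : f z ≤ r → ∀ v → f v ≤ g v
    g≥f fz≤r v with g-cases v
    ... | inj₁ (refl , eq) = subst (f v ≤_) (sym eq) fz≤r
    ... | inj₂ (_ , eq) = ≤-reflexive (sym eq)

    InH-f : ∀ u {v} → v ≢ z → InH g u v → InH f u v
    InH-f u {v} v≢z (pos , near) with g-cases v
    ... | inj₁ (v≡z , _) = ⊥-elim (v≢z v≡z)
    ... | inj₂ (_ , eq) = subst (0 <_) eq pos , subst (d u v ≤_) eq near

    g-packing : IsPacking f → CanRaise f z r → IsPacking g
    g-packing packing raisable u v w Hv Hw with g-cases v | g-cases w
    ... | inj₁ (v≡z , _) | inj₁ (w≡z , _) = trans v≡z (sym w≡z)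
    ... | inj₁ (refl , eq) | inj₂ (w≢z , _) =
      ⊥-elim (raisable u w w≢z (InH-f u w≢z Hw) (subst (d u v ≤_) eq (proj₂ Hv)))
    ... | inj₂ (v≢z , _) | inj₁ (refl , eq) =
      ⊥-elim (raisable u v v≢z (InH-f u v≢z Hv) (subst (d u w ≤_) eq (proj₂ Hw)))
    ... | inj₂ (v≢z , _) | inj₂ (w≢z , _) = packing u v w (InH-f u v≢z Hv) (InH-f u w≢z Hw)

    g-broadcast : IsBroadcast f → r ≤ ecc z → IsBroadcast g
    g-broadcast bc r≤ecc v with g-cases v
    ... | inj₁ (refl , eq) =
      subst (_≤ diam) (sym eq) (≤-trans r≤ecc (ecc≤diam v)) , subst (_≤ ecc v) (sym eq) r≤ecc
    ... | inj₂ (_ , eq) = subst (_≤ diam) (sym eq) (proj₁ (bc v)) , subst (_≤ ecc v) (sym eq) (proj₂ (bc v))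

  maximal⇒¬CanRaise : ∀ {f z r} → IsMaximalPackingBroadcast f → f z < r → r ≤ ecc z → ¬ CanRaise f z r
  maximal⇒¬CanRaise {f} {z} {r} ((bc , packing) , maximal) fz<r r≤ecc raisable =
    <-irrefl (sym (trans (sym g-at) g≡f)) fz<r
    where
    open Raise f z r
    g≡f : g z ≡ f z
    g≡f = maximal g (g-broadcast bc r≤ecc , g-packing packing raisable) (g≥f (<⇒≤ fz<r)) z

  -- Raising f v would put u into the ball of v as well as into the ball of c.
  Blocked : (Fin n → ℕ) → Fin n → Set
  Blocked f v = Σ (Fin n) λ c → Σ (Fin n) λ u → c ≢ v × InH f u c × d u v ≤ f v + 1

  maximal-if-blocked : ∀ f → IsPackingBroadcast f → (∀ v → ecc v ≤ f v ⊎ Blocked f v) →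
                       IsMaximalPackingBroadcast f
  maximal-if-blocked f pb blocked = pb , maximal
    where
    maximal : ∀ g → IsPackingBroadcast g → (∀ v → f v ≤ g v) → ∀ v → g v ≡ f v
    maximal g (bc , packing) f≤g v with blocked v
    ... | inj₁ ecc≤ = ≤-antisym (≤-trans (proj₂ (bc v)) ecc≤) (f≤g v)
    ... | inj₂ (c , u , c≢v , (pos , near) , near-v) with m≤n⇒m<n∨m≡n (f≤g v)
    ...   | inj₂ eq = sym eq
    ...   | inj₁ fv<gv = ⊥-elim (c≢v (packing u c v (≤-trans pos (f≤g c) , ≤-trans near (f≤g c))
                                  (≤-trans z<s fv<gv , ≤-trans near-v (subst (_≤ g v) (+-comm 1 (f v)) fv<gv))))

  Attains : ℕ → Set
  Attains m = Σ (Fin n → ℕ) λ f → IsMaximalPackingBroadcast f × cost f ≡ m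

  central : Fin n → ℕ
  central fzero = half
  central (fsuc _) = 0

  central-maximal : IsMaximalPackingBroadcast central
  central-maximal = maximal-if-blocked central (bc , packing) blocked
    where
    bc : IsBroadcast central
    bc v = ≤-trans (central≤half v) (≤-trans (half≤ecc v) (ecc≤diam v)) , ≤-trans (central≤half v) (half≤ecc v)
      where
      central≤half : ∀ v → central v ≤ half
      central≤half fzero = ≤-refl
      central≤half (fsuc _) = z≤n
    packing : IsPacking central
    packing u fzero fzero _ _ = refl
    packing u (fsuc _) w (() , _) _
    packing u fzero (fsuc _) _ (() , _)
    blocked : ∀ v → ecc v ≤ central v ⊎ Blocked central v
    blocked fzero = inj₁ (ecc≤half fzero)
    blocked v@(fsuc _) =
      inj₂ (fzero , v , (λ ()) , (1≤half , d≤half v fzero) , ≤-trans (≤-reflexive (d-refl v)) z≤n)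

  cost-central : cost central ≡ half
  cost-central = begin
    half + sum (map central (tabulate fsuc))   ≡⟨ cong (λ xs → half + sum xs) (map-tabulate fsuc central) ⟩
    half + sum (tabulate {n = 2 + k} (λ _ → 0)) ≡⟨ cong (half +_) (sum-tabulate-zero (2 + k)) ⟩
    half + 0                                   ≡⟨ +-identityʳ half ⟩
    half                                       ∎
    where open ≡-Reasoning

  cost≡partialSum : ∀ f h → (∀ i → h (toℕ i) ≡ f i) → cost f ≡ partialSum h n
  cost≡partialSum f h h≗f = trans (cong sum (map-tabulate (λ i → i) f)) (sum-tabulate n f h h≗f)

  module LowerBound (f : Fin n → ℕ) (f-maximal : IsMaximalPackingBroadcast f)
                    (small : ∀ v → 2 * f v + 2 ≤ n) where

    packing : IsPacking f
    packing = proj₂ (proj₁ f-maximal)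

    F : ℕ → ℕ
    F x = f (vertex x)

    F+n : ∀ x → F (x + n) ≡ F x
    F+n x = cong f (vertex-+n x)

    InH-within : ∀ {u x} → 0 < F x → Within (F x) u x → InH f (vertex u) (vertex x)
    InH-within pos near = pos , d-vertex-≤ near

    F+F<n : ∀ x → F x + F x < n
    F+F<n x = ≤-trans (≤-offset 1 (eq (F x))) (small (vertex x))
      where
      eq : ∀ a → suc (a + a) + 1 ≡ 2 * a + 2
      eq = solve-∀

    balls-disjoint : ∀ x y → x ≤ y → 0 < F x → 0 < F y → y ≤ x + (F x + F y) → x ≡ y
    balls-disjoint x y x≤y pos-x pos-y y≤ =
      %-injective-window x y (vertex-≡⇒%-≡ {x} {y} same) x≤y
        (≤-<-trans y≤ (+-monoʳ-< x (subst (λ t → F x + t < n) Fx≡Fy (F+F<n x))))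
      where
      same : vertex x ≡ vertex y
      same with y ≤? x + F x
      ... | yes y≤x+Fx = packing (vertex y) (vertex x) (vertex y)
              (InH-within pos-x (y≤x+Fx , ≤-trans x≤y (m≤m+n y (F x))))
              (pos-y , subst (_≤ F y) (sym (d-refl (vertex y))) z≤n)
      ... | no y≰x+Fx = packing (vertex (x + F x)) (vertex x) (vertex y)
              (InH-within pos-x (≤-refl , ≤-trans (m≤m+n x (F x)) (m≤m+n (x + F x) (F x))))
              (InH-within pos-y (≤-trans (<⇒≤ (≰⇒> y≰x+Fx)) (m≤m+n y (F y)) ,
                                 subst (y ≤_) (sym (+-assoc x (F x) (F y))) y≤))
      Fx≡Fy : F x ≡ F y
      Fx≡Fy = cong f same

    Consecutive : ℕ → ℕ → Set
    Consecutive a b = a < b × 0 < F b × (∀ z → a < z → z < b → F z ≡ 0)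

    unheard : ∀ {a b u} → 0 < F a → Consecutive a b → a + F a < u → u + F b < b → n ≤ u →
              ∀ v → ¬ InH f (vertex u) v
    unheard {a} {b} {u} pos-a (a<b , pos-b , between) a+Fa<u u+Fb<b n≤u v (pos-v , near-v) with lift u n≤u v
    ... | c , refl , near = from-side (≤-total c a)
      where
      near′ : Within (F c) u c
      near′ = within-mono near-v near
      from-side : c ≤ a ⊎ a ≤ c → ⊥
      from-side (inj₁ c≤a) = <-irrefl refl (<-≤-trans a+Fa<u (subst (λ t → u ≤ t + F t) c≡a (proj₁ near′)))
        where
        c≡a : c ≡ a
        c≡a = balls-disjoint c a c≤a pos-v pos-a (≤-trans (m≤m+n a (F a))
                (≤-trans (<⇒≤ (<-≤-trans a+Fa<u (proj₁ near′))) (+-monoʳ-≤ c (m≤m+n (F c) (F a)))))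
      from-side (inj₂ a≤c) with c <? b
      ... | yes c<b with a ≟ c
      ...   | yes refl = <-irrefl refl (<-≤-trans a+Fa<u (proj₁ near′))
      ...   | no a≢c = <-irrefl (sym (between c (≤∧≢⇒< a≤c a≢c) c<b)) pos-v
      from-side (inj₂ a≤c) | no c≮b =
        <-irrefl refl (<-≤-trans u+Fb<b (subst (λ t → t ≤ u + F t) (sym b≡c) (proj₂ near′)))
        where
        u<b : u < b
        u<b = ≤-<-trans (m≤m+n u (F b)) u+Fb<b
        b≡c : b ≡ c
        b≡c = balls-disjoint b c (≮⇒≥ c≮b) pos-b pos-v (≤-trans (proj₂ near′)
                (≤-trans (+-monoˡ-≤ (F c) (<⇒≤ u<b)) (+-monoʳ-≤ b (m≤n+m (F c) (F b)))))

    -- Otherwise the vertex two steps past the ball of a hears nobody and could broadcast.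
    gap≤2 : ∀ a b → n ≤ a → 0 < F a → Consecutive a b → b ≤ a + F a + F b + 3
    gap≤2 a b n≤a pos-a cons@(a<b , pos-b , between) with b ≤? a + F a + F b + 3
    ... | yes b≤ = b≤
    ... | no b≰ = ⊥-elim (maximal⇒¬CanRaise f-maximal Fw<1 (≤-trans 1≤half (half≤ecc (vertex w))) free)
      where
      w = a + F a + 2
      far : a + F a + F b + 3 < b
      far = ≰⇒> b≰
      a<w : a < w
      a<w = ≤-offset (F a + 1) (eq a (F a))
        where
        eq : ∀ a A → suc a + (A + 1) ≡ a + A + 2
        eq = solve-∀
      w<b : w < b
      w<b = ≤-<-trans (≤-offset (F b + 1) (eq (a + F a) (F b))) far
        where
        eq : ∀ A B → A + 2 + (B + 1) ≡ A + B + 3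
        eq = solve-∀
      Fw<1 : F w < 1
      Fw<1 = subst (_< 1) (sym (between w a<w w<b)) (s≤s z≤n)
      free : CanRaise f (vertex w) 1
      free u v _ Hv du≤1 with lift w (≤-trans n≤a (<⇒≤ a<w)) u
      ... | u′ , refl , near = unheard pos-a cons a+Fa<u′ u′+Fb<b n≤u′ v Hv
        where
        near₁ : Within 1 w u′
        near₁ = within-mono (subst (_≤ 1) (d-sym (vertex u′) (vertex w)) du≤1) near
        a+Fa<u′ : a + F a < u′
        a+Fa<u′ = s≤s⁻¹ (subst₂ _≤_ (eq (a + F a)) (+-comm u′ 1) (proj₁ near₁))
          where
          eq : ∀ A → A + 2 ≡ suc (suc A)
          eq = solve-∀
        u′+Fb<b : u′ + F b < b
        u′+Fb<b = ≤-<-trans (≤-trans (+-monoˡ-≤ (F b) (proj₂ near₁)) (≤-offset 0 (eq (a + F a) (F b)))) far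
          where
          eq : ∀ A B → A + 2 + 1 + B + 0 ≡ A + B + 3
          eq = solve-∀
        n≤u′ : n ≤ u′
        n≤u′ = ≤-trans n≤a (≤-trans (m≤m+n a (F a)) (<⇒≤ a+Fa<u′))

    -- Otherwise b's radius can grow by one.
    adjacent-gaps : ∀ a b c g₁ g₂ → n ≤ a → 0 < F a → Consecutive a b → Consecutive b c →
                    b ≡ a + F a + 1 + g₁ + F b → c ≡ b + F b + 1 + g₂ + F c → OneIsZero g₁ g₂
    adjacent-gaps a b c zero g₂ _ _ _ _ _ _ = inj₁ refl
    adjacent-gaps a b c (suc g₁) zero _ _ _ _ _ _ = inj₂ refl
    adjacent-gaps a b c (suc g₁) (suc g₂) n≤a pos-a cab@(a<b , pos-b , _) cbc b≡ c≡ =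
      ⊥-elim (maximal⇒¬CanRaise f-maximal (subst (F b <_) (+-comm 1 (F b)) ≤-refl)
               (≤-trans (≤-half (F b + 1) n (subst (_≤ n) (eq (F b)) (small (vertex b)))) (half≤ecc (vertex b))) free)
      where
      eq : ∀ x → 2 * x + 2 ≡ x + 1 + (x + 1)
      eq = solve-∀
      n≤b : n ≤ b
      n≤b = ≤-trans n≤a (<⇒≤ a<b)
      free : CanRaise f (vertex b) (F b + 1)
      free u v v≢b Hv du≤ with lift b n≤b u
      ... | u′ , refl , near with u′ ≤? b + F b | b ≤? u′ + F b
      ...   | yes u′≤ | yes b≤ = v≢b (sym (packing (vertex u′) (vertex b) v (InH-within pos-b (u′≤ , b≤)) Hv))
      ...   | yes _ | no b≰ =
        unheard pos-a cab a+Fa<u′ (≰⇒> b≰) (≤-trans n≤a (≤-trans (m≤m+n a (F a)) (<⇒≤ a+Fa<u′))) v Hv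
        where
        near₁ : Within (F b + 1) b u′
        near₁ = within-mono (subst (_≤ F b + 1) (d-sym (vertex u′) (vertex b)) du≤) near
        a+Fa<u′ : a + F a < u′
        a+Fa<u′ = +-cancelʳ-≤ (F b + 1) _ _
          (≤-trans (≤-offset g₁ (eq₁ (a + F a) g₁ (F b))) (subst (_≤ u′ + (F b + 1)) b≡ (proj₁ near₁)))
          where
          eq₁ : ∀ A g B → suc A + (B + 1) + g ≡ A + 1 + suc g + B
          eq₁ = solve-∀
      ...   | no u′≰ | _ =
        unheard pos-b cbc (≰⇒> u′≰) u′+Fc<c (≤-trans n≤b (≤-trans (m≤m+n b (F b)) (<⇒≤ (≰⇒> u′≰)))) v Hv
        where
        near₁ : Within (F b + 1) b u′
        near₁ = within-mono (subst (_≤ F b + 1) (d-sym (vertex u′) (vertex b)) du≤) near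
        u′+Fc<c : u′ + F c < c
        u′+Fc<c = subst (u′ + F c <_) (sym c≡)
          (≤-trans (+-monoˡ-≤ (F c) (s≤s (proj₂ near₁))) (≤-offset g₂ (eq₂ b (F b) g₂ (F c))))
          where
          eq₂ : ∀ b B g C → suc (b + (B + 1)) + C + g ≡ b + B + 1 + suc g + C
          eq₂ = solve-∀

    next-positive : ∀ δ a → 0 < F (a + suc δ) → Σ ℕ λ b → Consecutive a b × b ≤ a + suc δ
    next-positive δ a pos with F (suc a) ≟ 0
    next-positive δ a pos | no F≢0 =
      suc a , (≤-refl , n≢0⇒n>0 F≢0 , λ z a<z z<1+a → ⊥-elim (<-irrefl refl (<-≤-trans a<z (s≤s⁻¹ z<1+a)))) ,
      subst (suc a ≤_) (sym (+-suc a δ)) (s≤s (m≤m+n a δ))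
    next-positive zero a pos | yes F≡0 = ⊥-elim (<-irrefl (sym (trans (cong F (+-comm a 1)) F≡0)) pos)
    next-positive (suc δ) a pos | yes F≡0 with next-positive δ (suc a) (subst (λ t → 0 < F t) (+-suc a (suc δ)) pos)
    ... | b , (1+a<b , pos-b , between) , b≤ =
      b , (<-trans ≤-refl 1+a<b , pos-b , between′) , subst (b ≤_) (sym (+-suc a (suc δ))) b≤
      where
      between′ : ∀ z → a < z → z < b → F z ≡ 0
      between′ z a<z z<b with z ≟ suc a
      ... | yes refl = F≡0
      ... | no z≢1+a = between z (≤∧≢⇒< a<z (λ eq → z≢1+a (sym eq))) z<b

    gap-decomposition : ∀ a A B b → a + A + B < b → b ≤ a + A + B + 3 → Σ ℕ λ g → b ≡ a + A + 1 + g + B × g ≤ 2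
    gap-decomposition a A B b lt le = g , trans (sym b≡) (eq a A B g) ,
      +-cancelˡ-≤ (X + 1) g 2 (subst (_≤ X + 1 + 2) (sym b≡) (subst (b ≤_) (sym (+-assoc X 1 2)) le))
      where
      X = a + A + B
      g = b ∸ (X + 1)
      b≡ : X + 1 + g ≡ b
      b≡ = m+[n∸m]≡n (subst (_≤ b) (+-comm 1 X) lt)
      eq : ∀ a A B g → a + A + B + 1 + g ≡ a + A + 1 + g + B
      eq = solve-∀

    -- The broadcasting positions from a to e on the cover; g counts the vertices strictly between
    -- the balls of two consecutive ones.
    data Chain : ℕ → ℕ → Set where
      done : ∀ {a} → Chain a a
      step : ∀ {a e} b g → Consecutive a b → b ≡ a + F a + 1 + g + F b → g ≤ 2 → Chain b e → Chain a e

    chain : ∀ fuel a e → e ≤ a + fuel → a ≤ e → n ≤ a → 0 < F a → 0 < F e → Chain a e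
    chain fuel a e e≤ a≤e n≤a pos-a pos-e with a <? e
    chain fuel a e e≤ a≤e n≤a pos-a pos-e | no a≮e with ≤-antisym a≤e (≮⇒≥ a≮e)
    ... | refl = done
    chain zero a e e≤ a≤e n≤a pos-a pos-e | yes a<e =
      ⊥-elim (<-irrefl refl (<-≤-trans a<e (subst (e ≤_) (+-identityʳ a) e≤)))
    chain (suc fuel) a e e≤ a≤e n≤a pos-a pos-e | yes a<e
      with next-positive (e ∸ suc a) a (subst (λ t → 0 < F t) (sym a+[e∸a]) pos-e)
      where
      a+[e∸a] : a + suc (e ∸ suc a) ≡ e
      a+[e∸a] = trans (+-suc a _) (m+[n∸m]≡n a<e)
    ... | b , cab@(a<b , pos-b , _) , b≤ with gap-decomposition a (F a) (F b) b separated (gap≤2 a b n≤a pos-a cab)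
      where
      separated : a + F a + F b < b
      separated with b ≤? a + (F a + F b)
      ... | yes b≤′ = ⊥-elim (<-irrefl (balls-disjoint a b (<⇒≤ a<b) pos-a pos-b b≤′) a<b)
      ... | no b≰ = subst (_< b) (sym (+-assoc a (F a) (F b))) (≰⇒> b≰)
    ... | g , b≡ , g≤2 = step b g cab b≡ g≤2 (chain fuel b e e≤′ (subst (b ≤_) (trans (+-suc a _) (m+[n∸m]≡n a<e)) b≤)
                                                      (≤-trans n≤a (<⇒≤ a<b)) pos-b pos-e)
      where
      e≤′ : e ≤ b + fuel
      e≤′ = ≤-trans e≤ (subst (_≤ b + fuel) (sym (+-suc a fuel)) (+-monoˡ-≤ fuel a<b))

    links : ∀ {a e} → Chain a e → ℕ
    links done = 0
    links (step _ _ _ _ _ ch) = suc (links ch)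

    radii : ∀ {a e} → Chain a e → ℕ
    radii done = 0
    radii {a} (step _ _ _ _ _ ch) = F a + radii ch

    gaps : ∀ {a e} → Chain a e → List ℕ
    gaps done = []
    gaps (step _ g _ _ _ ch) = g ∷ gaps ch

    chain-span : ∀ {a e} (ch : Chain a e) → a + 2 * radii ch + links ch + sum (gaps ch) + F e ≡ e + F a
    chain-span {a} done = eq a (F a)
      where
      eq : ∀ a A → a + 2 * 0 + 0 + 0 + A ≡ a + A
      eq = solve-∀
    chain-span {a} {e} (step b g _ b≡ _ ch) = +-cancelʳ-≡ (F b) _ _ (begin
      a + 2 * (F a + radii ch) + suc (links ch) + (g + sum (gaps ch)) + F e + F b
        ≡⟨ eq₁ a (F a) g (F b) (F e) (radii ch) (links ch) (sum (gaps ch)) ⟩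
      (a + F a + 1 + g + F b) + 2 * radii ch + links ch + sum (gaps ch) + F e + F a
        ≡⟨ cong (λ t → t + 2 * radii ch + links ch + sum (gaps ch) + F e + F a) b≡ ⟨
      b + 2 * radii ch + links ch + sum (gaps ch) + F e + F a
        ≡⟨ cong (_+ F a) (chain-span ch) ⟩
      e + F b + F a
        ≡⟨ eq₂ e (F b) (F a) ⟩
      e + F a + F b ∎)
      where
      open ≡-Reasoning
      eq₁ : ∀ a A g B E s l G → a + 2 * (A + s) + suc l + (g + G) + E + B ≡ (a + A + 1 + g + B) + 2 * s + l + G + E + A
      eq₁ = solve-∀
      eq₂ : ∀ e B A → e + B + A ≡ e + A + B
      eq₂ = solve-∀

    links≤radii : ∀ {a e} (ch : Chain a e) → 0 < F a → links ch ≤ radii ch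
    links≤radii done _ = z≤n
    links≤radii (step _ _ (_ , pos-b , _) _ _ ch) pos-a = +-mono-≤ pos-a (links≤radii ch pos-b)

    partialSum-silent : ∀ a b → (∀ z → a < z → z < b → F z ≡ 0) → ∀ δ → suc a + δ ≤ b →
                        partialSum F (suc a + δ) ≡ partialSum F (suc a)
    partialSum-silent a b between zero _ = cong (partialSum F) (+-identityʳ (suc a))
    partialSum-silent a b between (suc δ) ≤b = begin
      partialSum F (suc a + suc δ)                ≡⟨ cong (partialSum F) (+-suc (suc a) δ) ⟩
      partialSum F (suc a + δ) + F (suc a + δ)
        ≡⟨ cong (partialSum F (suc a + δ) +_) (between (suc a + δ) (s≤s (m≤m+n a δ)) <b) ⟩
      partialSum F (suc a + δ) + 0                ≡⟨ +-identityʳ _ ⟩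
      partialSum F (suc a + δ)                    ≡⟨ partialSum-silent a b between δ (<⇒≤ <b) ⟩
      partialSum F (suc a)                        ∎
      where
      open ≡-Reasoning
      <b : suc a + δ < b
      <b = subst (_≤ b) (+-suc (suc a) δ) ≤b

    partialSum-chain : ∀ {a e} (ch : Chain a e) → partialSum F a + radii ch ≡ partialSum F e
    partialSum-chain {a} done = +-identityʳ (partialSum F a)
    partialSum-chain {a} (step b _ (a<b , _ , between) _ _ ch) =
      trans (sym (+-assoc (partialSum F a) (F a) (radii ch))) (trans (cong (_+ radii ch) to-b) (partialSum-chain ch))
      where
      to-b : partialSum F (suc a) ≡ partialSum F b
      to-b = sym (trans (cong (partialSum F) (sym (m+[n∸m]≡n a<b)))
                        (partialSum-silent a b between (b ∸ suc a) (≤-reflexive (m+[n∸m]≡n a<b))))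

    partialSum-period : ∀ x → partialSum F (x + n) ≡ partialSum F x + partialSum F n
    partialSum-period zero = refl
    partialSum-period (suc x) = trans (cong₂ _+_ (partialSum-period x) (F+n x)) (eq (partialSum F x) (partialSum F n) (F x))
      where
      eq : ∀ a b c → a + b + c ≡ a + c + b
      eq = solve-∀

    gaps≤2 : ∀ {a e} (ch : Chain a e) → All (_≤ 2) (gaps ch)
    gaps≤2 done = []
    gaps≤2 (step _ _ _ _ g≤2 ch) = g≤2 ∷ gaps≤2 ch

    gaps-linked : ∀ {a e} (ch : Chain a e) → n ≤ a → 0 < F a → Linked OneIsZero (gaps ch)
    gaps-linked done _ _ = []
    gaps-linked (step _ _ _ _ _ done) _ _ = [-]
    gaps-linked {a} (step b g cab b≡ _ ch@(step c g′ cbc c≡ _ _)) n≤a pos-a =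
      adjacent-gaps a b c g g′ n≤a pos-a cab cbc b≡ c≡ ∷
      gaps-linked ch (≤-trans n≤a (<⇒≤ (proj₁ cab))) (proj₁ (proj₂ cab))

    length-gaps : ∀ {a e} (ch : Chain a e) → length (gaps ch) ≡ links ch
    length-gaps done = refl
    length-gaps (step _ _ _ _ _ ch) = cong suc (length-gaps ch)

    LastLink : ℕ → ℕ → Set
    LastLink e gₑ = Σ ℕ λ a′ → n ≤ a′ × 0 < F a′ × Consecutive a′ e × e ≡ a′ + F a′ + 1 + gₑ + F e

    last-link : ∀ {a e} b g → Consecutive a b → b ≡ a + F a + 1 + g + F b → (ch : Chain b e) → n ≤ a → 0 < F a →
                LastLink e (lastOr g (gaps ch))
    last-link {a} b g cab b≡ done n≤a pos-a = a , n≤a , pos-a , cab , b≡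
    last-link b g cab b≡ (step c g′ cbc c≡ _ ch) n≤a pos-a =
      last-link c g′ cbc c≡ ch (≤-trans n≤a (<⇒≤ (proj₁ cab))) (proj₁ (proj₂ cab))

    consecutive-+n : ∀ a b → Consecutive a b → Consecutive (a + n) (b + n)
    consecutive-+n a b (a<b , pos-b , between) = +-monoˡ-< n a<b , subst (0 <_) (sym (F+n b)) pos-b , between′
      where
      between′ : ∀ z → a + n < z → z < b + n → F z ≡ 0
      between′ z a+n<z z<b+n = trans (cong F (sym z≡)) (trans (F+n (z ∸ n))
        (between (z ∸ n) (+-cancelʳ-< n a _ (subst (a + n <_) (sym z≡) a+n<z))
                         (+-cancelʳ-< n _ b (subst (_< b + n) (sym z≡) z<b+n))))
        where
        z≡ : z ∸ n + n ≡ z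
        z≡ = m∸n+n≡m (≤-trans (m≤n+m n a) (<⇒≤ a+n<z))

    closed-chain-admissible : ∀ a e (ch : Chain a e) → e ≡ a + n → n ≤ a → 0 < F a → Admissible n (radii ch)
    closed-chain-admissible a .a done a≡a+n _ _ =
      ⊥-elim (<-irrefl (sym (+-cancelˡ-≡ a n 0 (trans (sym a≡a+n) (sym (+-identityʳ a))))) z<s)
    closed-chain-admissible a e ch@(step b g cab b≡ _ rest) refl n≤a pos-a with last-link b g cab b≡ rest n≤a pos-a
    ... | a′ , n≤a′ , pos-a′ , ca′ , e≡ = admissible-from-gaps span (links≤radii ch pos-a)
          (subst (λ m → sum (gaps ch) < m ⊎ (sum (gaps ch) ≤ m × 2 ∣ sum (gaps ch))) (length-gaps ch)
                 (cyclic-gaps g (gaps rest) (gaps≤2 ch) (gaps-linked ch n≤a pos-a) wrap))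
      where
      span : n ≡ 2 * radii ch + links ch + sum (gaps ch)
      span = sym (+-cancelˡ-≡ a _ _ (+-cancelʳ-≡ (F a) _ _ (trans (eq a (2 * radii ch) (links ch) (sum (gaps ch)) (F a))
               (trans (cong (λ t → a + 2 * radii ch + links ch + sum (gaps ch) + t) (sym (F+n a))) (chain-span ch)))))
        where
        eq : ∀ a K l P A → a + (K + l + P) + A ≡ a + K + l + P + A
        eq = solve-∀
      b+n≡ : b + n ≡ (a + n) + F (a + n) + 1 + g + F (b + n)
      b+n≡ = trans (cong (_+ n) b≡) (trans (eq a (F a) g (F b) n)
               (cong₂ (λ s t → (a + n) + s + 1 + g + t) (sym (F+n a)) (sym (F+n b))))
        where
        eq : ∀ a A g B n → a + A + 1 + g + B + n ≡ a + n + A + 1 + g + B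
        eq = solve-∀
      -- The last gap of the chain and its first gap, shifted by n, are adjacent around the cycle.
      wrap : OneIsZero g (lastOr g (gaps rest))
      wrap with adjacent-gaps a′ (a + n) (b + n) _ g n≤a′ pos-a′ ca′ (consecutive-+n a b cab) e≡ b+n≡
      ... | inj₁ last≡0 = inj₂ last≡0
      ... | inj₂ g≡0 = inj₁ g≡0

    admissible-cost : ∀ v → 0 < f v → Admissible n (cost f)
    admissible-cost v pos-v = subst (Admissible n) radii≡cost (closed-chain-admissible s (s + n) ch refl n≤s pos-s)
      where
      s = toℕ v + n
      pos-s : 0 < F s
      pos-s = subst (0 <_) (sym (cong f (trans (vertex-+n (toℕ v)) (vertex-toℕ v)))) pos-v
      n≤s : n ≤ s
      n≤s = m≤n+m n (toℕ v)
      ch : Chain s (s + n)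
      ch = chain n s (s + n) ≤-refl (m≤m+n s n) n≤s pos-s (subst (0 <_) (sym (F+n s)) pos-s)
      radii≡cost : radii ch ≡ cost f
      radii≡cost = trans (+-cancelˡ-≡ (partialSum F s) _ _ (trans (partialSum-chain ch) (partialSum-period s)))
                         (sym (cost≡partialSum f F (λ i → cong f (vertex-toℕ i))))

  pbFormula≤cost : ∀ f → IsMaximalPackingBroadcast f → pbFormula n ≤ cost f
  pbFormula≤cost f maximal with any? (λ v → n <? 2 * f v + 2)
  ... | yes (v , n<) = ≤-trans pbFormula≤fv (≤-sum-map f (allFin n) (∈-allFin v))
    where
    pbFormula≤fv : pbFormula n ≤ f v
    pbFormula≤fv = s≤s⁻¹ (*-cancelˡ-< 2 _ _
      (≤-<-trans (pbFormula-half n (s≤s (s≤s (s≤s z≤n)))) (subst (n <_) (eq (f v)) n<)))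
      where
      eq : ∀ x → 2 * x + 2 ≡ 2 * suc x
      eq = solve-∀
  ... | no ∄big with any? (λ v → 0 <? f v)
  ...   | yes (v , pos) = pbFormula-least n (cost f) (LowerBound.admissible-cost f maximal small v pos)
    where
    small : ∀ v → 2 * f v + 2 ≤ n
    small v = ≮⇒≥ (λ n< → ∄big (v , n<))
  ...   | no silent = ⊥-elim (maximal⇒¬CanRaise maximal (s≤s (≮⇒≥ (λ pos → silent (fzero , pos))))
                                 (≤-trans 1≤half (half≤ecc fzero)) (λ _ v _ (pos , _) _ → silent (v , pos)))

  module WordBroadcast (w : List Bool) (length-w : length w ≡ n) (6≤n : 6 ≤ n)
                       (windows : T (allWindows (w ++ take 6 w))) where

    f : Fin n → ℕ
    f v = bit (bitAt w (toℕ v))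

    B : ℕ → Bool
    B x = bitAt w (x % n)

    f-vertex : ∀ x → f (vertex x) ≡ bit (B x)
    f-vertex x = cong (λ i → bit (bitAt w i)) (toℕ-vertex x)

    f≤1 : ∀ v → f v ≤ 1
    f≤1 v with bitAt w (toℕ v)
    ... | true = ≤-refl
    ... | false = z≤n

    B+n : ∀ x → B (x + n) ≡ B x
    B+n x = cong (bitAt w) ([m+n]%n≡m%n x n)

    bitAt-cyclic : ∀ i → i < n + 6 → bitAt (w ++ take 6 w) i ≡ bitAt w (i % n)
    bitAt-cyclic i i< with i <? n
    ... | yes i<n = trans (bitAt-++ˡ w (take 6 w) (subst (i <_) (sym length-w) i<n)) (cong (bitAt w) (sym (m<n⇒m%n≡m i<n)))
    ... | no i≮n = begin
      bitAt (w ++ take 6 w) i               ≡⟨ cong (bitAt (w ++ take 6 w)) (sym i≡) ⟩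
      bitAt (w ++ take 6 w) (length w + δ)  ≡⟨ bitAt-++ʳ w (take 6 w) δ ⟩
      bitAt (take 6 w) δ                    ≡⟨ bitAt-take 6 w δ<6 ⟩
      bitAt w δ                             ≡⟨ cong (bitAt w) i%n≡δ ⟨
      bitAt w (i % n)                       ∎
      where
      open ≡-Reasoning
      δ = i ∸ n
      n+δ≡i : n + δ ≡ i
      n+δ≡i = m+[n∸m]≡n (≮⇒≥ i≮n)
      i≡ : length w + δ ≡ i
      i≡ = trans (cong (_+ δ) length-w) n+δ≡i
      δ<6 : δ < 6
      δ<6 = +-cancelˡ-< n δ 6 (subst (_< n + 6) (sym n+δ≡i) i<)
      i%n≡δ : i % n ≡ δ
      i%n≡δ = trans (cong (_% n) (trans (sym n+δ≡i) (+-comm n δ)))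
                    (trans ([m+n]%n≡m%n δ n) (m<n⇒m%n≡m (<-≤-trans δ<6 6≤n)))

    B-window : ∀ x → Window B x
    B-window x = window-cong {bitAt (w ++ take 6 w)} {B} {x % n} {x} shift (windowAt (w ++ take 6 w) (x % n) windows fits)
      where
      fits : 7 + x % n ≤ length (w ++ take 6 w)
      fits = subst (7 + x % n ≤_) (sym length-cyclic) (subst (_≤ n + 6) (+-comm (suc (x % n)) 6) (+-monoˡ-≤ 6 (m%n<n x n)))
        where
        length-cyclic : length (w ++ take 6 w) ≡ n + 6
        length-cyclic = trans (length-++ w)
          (cong₂ _+_ length-w (trans (length-take 6 w) (m≤n⇒m⊓n≡m (subst (6 ≤_) (sym length-w) 6≤n))))
      shift : ∀ j → j ≤ 6 → bitAt (w ++ take 6 w) (x % n + j) ≡ B (x + j)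
      shift j j≤6 = trans (bitAt-cyclic (x % n + j) (+-mono-<-≤ (m%n<n x n) j≤6)) (cong (bitAt w) (%-shift j))
        where
        %-shift : ∀ j → (x % n + j) % n ≡ (x + j) % n
        %-shift j = trans (sym ([m+kn]%n≡m%n (x % n + j) (x / n) n))
                      (cong (_% n) (trans (eq (x % n) j (x / n * n)) (cong (_+ j) (sym (m≡m%n+[m/n]*n x n)))))
          where
          eq : ∀ a j t → a + j + t ≡ a + t + j
          eq = solve-∀

    isolated-at : ∀ x → B (x + 3) ≡ true → B (x + 4) ≡ false × B (x + 5) ≡ false
    isolated-at x =
      goodWindow-isolated (B (x + 0)) (B (x + 1)) (B (x + 2)) (B (x + 3)) (B (x + 4)) (B (x + 5)) (B (x + 6)) (B-window x)

    near-at : ∀ x → B (x + 3) ≡ false →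
              B (x + 4) ≡ true ⊎ B (x + 5) ≡ true ⊎ B (x + 2) ≡ true ⊎ B (x + 1) ≡ true
    near-at x =
      goodWindow-near (B (x + 0)) (B (x + 1)) (B (x + 2)) (B (x + 3)) (B (x + 4)) (B (x + 5)) (B (x + 6)) (B-window x)

    far-at : ∀ x → B (x + 3) ≡ true → B (x + 6) ≡ true ⊎ B (x + 0) ≡ true
    far-at x =
      goodWindow-far (B (x + 0)) (B (x + 1)) (B (x + 2)) (B (x + 3)) (B (x + 4)) (B (x + 5)) (B (x + 6)) (B-window x)

    -- The window of B starting at toℕ v + k is centred at toℕ v + n, a position of v;
    -- starting there avoids a truncated subtraction toℕ v ∸ 3.
    centre : ∀ y j → y + k + (3 + j) ≡ y + j + n
    centre y j = eq y k j
      where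
      eq : ∀ y k j → y + k + (3 + j) ≡ y + j + (3 + k)
      eq = solve-∀

    B-centre : ∀ y j → B (y + k + (3 + j)) ≡ B (y + j)
    B-centre y j = trans (cong B (centre y j)) (B+n (y + j))

    vertex-centre : ∀ v → vertex (toℕ v + k + 3) ≡ v
    vertex-centre v = trans (cong vertex (trans (centre (toℕ v) 0) (cong (_+ n) (+-identityʳ (toℕ v)))))
                            (trans (vertex-+n (toℕ v)) (vertex-toℕ v))

    B-isolated : ∀ y → B y ≡ true → B (y + 1) ≡ false × B (y + 2) ≡ false
    B-isolated y By with isolated-at (y + k) (trans (B-centre y 0) (trans (cong B (+-identityʳ y)) By))
    ... | B₄ , B₅ = trans (sym (B-centre y 1)) B₄ , trans (sym (B-centre y 2)) B₅

    ones-apart : ∀ a b → a ≤ b → b ≤ a + 2 → B a ≡ true → B b ≡ true → a ≡ b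
    ones-apart a b a≤b b≤ Ba Bb with b ∸ a | m+[n∸m]≡n a≤b
    ... | zero | a+0≡b = trans (sym (+-identityʳ a)) a+0≡b
    ... | suc zero | refl = ⊥-elim (true≢false (trans (sym Bb) (proj₁ (B-isolated a Ba))))
    ... | suc (suc zero) | refl = ⊥-elim (true≢false (trans (sym Bb) (proj₂ (B-isolated a Ba))))
    ... | suc (suc (suc δ)) | refl =
      ⊥-elim (<-irrefl refl (+-cancelˡ-≤ a 3 2 (≤-trans (+-monoʳ-≤ a (≤ᵇ⇒≤ 3 (3 + δ) tt)) b≤)))

    ones-within : ∀ {a b} → Within 2 a b → B a ≡ true → B b ≡ true → a ≡ b
    ones-within {a} {b} (a≤ , b≤) Ba Bb with ≤-total a b
    ... | inj₁ a≤b = ones-apart a b a≤b b≤ Ba Bb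
    ... | inj₂ b≤a = sym (ones-apart b a b≤a a≤ Bb Ba)

    bit-positive : ∀ {b} → 0 < bit b → b ≡ true
    bit-positive {true} _ = refl

    lift-heard : ∀ u v → InH f u v → Σ ℕ λ c → vertex c ≡ v × B c ≡ true × Within 1 (toℕ u + n) c
    lift-heard u v (pos , near) with lift (toℕ u + n) (m≤n+m n (toℕ u)) v
    ... | c , refl , within = c , refl , bit-positive (subst (0 <_) (f-vertex c) pos) , within-mono d≤1 within
      where
      d≤1 : d (vertex (toℕ u + n)) (vertex c) ≤ 1
      d≤1 = subst (λ t → d t (vertex c) ≤ 1) (sym (trans (vertex-+n (toℕ u)) (vertex-toℕ u)))
                  (≤-trans near (f≤1 (vertex c)))

    packing : IsPacking f
    packing u v w Hv Hw with lift-heard u v Hv | lift-heard u w Hw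
    ... | c , refl , Bc , (p≤c , c≤p) | c′ , refl , Bc′ , (p≤c′ , c′≤p) =
      cong vertex (ones-within (two c≤p p≤c′ , two c′≤p p≤c) Bc Bc′)
      where
      two : ∀ {x y} → x ≤ toℕ u + n + 1 → toℕ u + n ≤ y + 1 → x ≤ y + 2
      two {x} {y} x≤ ≤y = ≤-trans x≤ (subst (toℕ u + n + 1 ≤_) (+-assoc y 1 1) (+-monoˡ-≤ 1 ≤y))

    broadcast : IsBroadcast f
    broadcast v = ≤-trans f≤ecc (ecc≤diam v) , f≤ecc
      where
      f≤ecc : f v ≤ ecc v
      f≤ecc = ≤-trans (f≤1 v) (≤-trans 1≤half (half≤ecc v))

    blocked-by : ∀ v c u → B c ≡ true → Within 1 u c → Within (f v + 1) u (toℕ v + k + 3) → vertex c ≢ v →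
                 Blocked f v
    blocked-by v c u Bc near-c near-v c≢v =
      vertex c , vertex u , c≢v , (subst (0 <_) (sym fc≡1) z<s , ≤-trans (d-vertex-≤ near-c) (≤-reflexive (sym fc≡1))) ,
      subst (λ t → d (vertex u) t ≤ f v + 1) (vertex-centre v) (d-vertex-≤ near-v)
      where
      fc≡1 : f (vertex c) ≡ 1
      fc≡1 = trans (f-vertex c) (cong bit Bc)

    blocked : ∀ v → Blocked f v
    blocked v with B (toℕ v + k + 3) in B₃
    ... | false = silent (near-at x B₃)
      where
      x = toℕ v + k
      fv≡0 : f v ≡ 0
      fv≡0 = trans (cong f (sym (vertex-centre v))) (trans (f-vertex (x + 3)) (cong bit B₃))
      within₁ : ∀ {a b} → a ≤ b + 1 → b ≤ a + 1 → Within (f v + 1) (x + a) (x + b)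
      within₁ a≤ b≤ = subst (λ t → Within (t + 1) _ _) (sym fv≡0) (within-+ x a≤ b≤)
      c≢v : ∀ c → B c ≡ true → vertex c ≢ v
      c≢v c Bc eq = 1+n≢0 (trans (sym (trans (f-vertex c) (cong bit Bc))) (trans (cong f eq) fv≡0))
      silent : B (x + 4) ≡ true ⊎ B (x + 5) ≡ true ⊎ B (x + 2) ≡ true ⊎ B (x + 1) ≡ true → Blocked f v
      silent (inj₁ B₄) = blocked-by v (x + 4) (x + 4) B₄ (within-+ x (≤ᵇ⇒≤ 4 5 tt) (≤ᵇ⇒≤ 4 5 tt))
                           (within₁ (≤ᵇ⇒≤ 4 4 tt) (≤ᵇ⇒≤ 3 5 tt)) (c≢v (x + 4) B₄)
      silent (inj₂ (inj₁ B₅)) = blocked-by v (x + 5) (x + 4) B₅ (within-+ x (≤ᵇ⇒≤ 4 6 tt) (≤ᵇ⇒≤ 5 5 tt))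
                                  (within₁ (≤ᵇ⇒≤ 4 4 tt) (≤ᵇ⇒≤ 3 5 tt)) (c≢v (x + 5) B₅)
      silent (inj₂ (inj₂ (inj₁ B₂))) = blocked-by v (x + 2) (x + 2) B₂ (within-+ x (≤ᵇ⇒≤ 2 3 tt) (≤ᵇ⇒≤ 2 3 tt))
                                         (within₁ (≤ᵇ⇒≤ 2 4 tt) (≤ᵇ⇒≤ 3 3 tt)) (c≢v (x + 2) B₂)
      silent (inj₂ (inj₂ (inj₂ B₁))) = blocked-by v (x + 1) (x + 2) B₁ (within-+ x (≤ᵇ⇒≤ 2 2 tt) (≤ᵇ⇒≤ 1 3 tt))
                                         (within₁ (≤ᵇ⇒≤ 2 4 tt) (≤ᵇ⇒≤ 3 3 tt)) (c≢v (x + 1) B₁)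
    ... | true = speaking (far-at x B₃)
      where
      x = toℕ v + k
      fv≡1 : f v ≡ 1
      fv≡1 = trans (cong f (sym (vertex-centre v))) (trans (f-vertex (x + 3)) (cong bit B₃))
      within₂ : ∀ {a b} → a ≤ b + 2 → b ≤ a + 2 → Within (f v + 1) (x + a) (x + b)
      within₂ a≤ b≤ = subst (λ t → Within (t + 1) _ _) (sym fv≡1) (within-+ x a≤ b≤)
      3<n : 3 < n
      3<n = ≤-trans (≤ᵇ⇒≤ 4 6 tt) 6≤n
      speaking : B (x + 6) ≡ true ⊎ B (x + 0) ≡ true → Blocked f v
      speaking (inj₁ B₆) = blocked-by v (x + 6) (x + 5) B₆ (within-+ x (≤ᵇ⇒≤ 5 7 tt) (≤ᵇ⇒≤ 6 6 tt))
        (within₂ (≤ᵇ⇒≤ 5 5 tt) (≤ᵇ⇒≤ 3 7 tt))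
        (λ eq → vertex-+-injective x (≤ᵇ⇒≤ 4 6 tt) (+-monoʳ-< 3 3<n) (trans (vertex-centre v) (sym eq)))
      speaking (inj₂ B₀) = blocked-by v (x + 0) (x + 1) B₀ (within-+ x (≤ᵇ⇒≤ 1 1 tt) (≤ᵇ⇒≤ 0 2 tt))
        (within₂ (≤ᵇ⇒≤ 1 5 tt) (≤ᵇ⇒≤ 3 3 tt))
        (λ eq → vertex-+-injective x (≤ᵇ⇒≤ 1 3 tt) (<-≤-trans 3<n ≤-refl) (trans eq (sym (vertex-centre v))))

    maximal : IsMaximalPackingBroadcast f
    maximal = maximal-if-blocked f (broadcast , packing) (λ v → inj₂ (blocked v))

    cost≡popcount : cost f ≡ popcount w
    cost≡popcount = trans (cost≡partialSum f (λ x → bit (bitAt w x)) (λ _ → refl))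
      (trans (cong (partialSum (λ x → bit (bitAt w x))) (sym length-w)) (partialSum-popcount w))

  central-attains : Attains half
  central-attains = central , central-maximal , cost-central

  word-attains : 6 ≤ n → Attains (pbFormula n)
  word-attains 6≤n = f , maximal , trans cost≡popcount (sym formula)
    where
    r = (n ∸ 6) % 8
    q = (n ∸ 6) / 8
    r<8 : r < 8
    r<8 = m%n<n (n ∸ 6) 8
    n≡ : n ≡ 6 + r + q * 8
    n≡ = trans (sym (m+[n∸m]≡n 6≤n)) (trans (cong (6 +_) (m≡m%n+[m/n]*n (n ∸ 6) 8)) (sym (+-assoc 6 r (q * 8))))
    open WordBroadcast (word q r) (trans (length-word q r r<8) (sym n≡)) 6≤n (word-windows q r r<8)
    formula : pbFormula n ≡ popcount (word q r)
    formula = trans (cong pbFormula n≡) (pbFormula-word q r r<8)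

attains-pbFormula : ∀ k → Cycle.Attains k (pbFormula (3 + k))
attains-pbFormula 0 = Cycle.central-attains 0
attains-pbFormula 1 = Cycle.central-attains 1
attains-pbFormula 2 = Cycle.central-attains 2
attains-pbFormula k@(suc (suc (suc _))) = Cycle.word-attains k (m≤m+n 6 _)

theorem3p17 : (n : ℕ) → 3 ≤ n → pbCycle n (pbFormula n)
theorem3p17 (suc (suc (suc k))) (s≤s (s≤s (s≤s z≤n))) = attains-pbFormula k , Cycle.pbFormula≤cost k
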